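{- Let $f(x)\in\mathbb{Z}[x]$ have degree $d\ge 2$ and let $t\in\mathbb{Z}$ be a wandering point for $f$. Let $r\in(0,1)$ and let $p_1<p_2<p_3<\cdots$ be the sequence of rational primes in increasing order. If $k$ is a positive integer such that $$\delta_k=1-\prod_{i=1}^k\left(1-\frac{1}{p_i}\right)<r,$$ then $r$ is not $(f,t,k)$-accessible. In particular, there do not exist $k$ polynomials $g_1(x)=x+a_1,\dots,g_k(x)=x+a_k$ with $a_i\in\mathbb{Z}$ such that $\delta_{f,t}\left(\bigcup_{i=1}^k\operatorname{Orb}^{\pm}_{g_i}(t)\right)=r$.
   Context: $\operatorname{Orb}_f(t)=\{f^n(t):n\ge0\}$ ($f^0(x)=x$, $f^n=f\circ f^{n-1}$); $t$ is wandering if this set is infinite. For $g(x)=x+a$, $a\in\mathbb{Z}$, $\operatorname{Orb}^{\pm}_g(t)=\{t+na:n\in\mathbb{Z}\}$. For $A\subseteq\mathbb{Z}$, $$\delta_{f,t}(A)=\lim_{X\to\infty}\frac{|\{x\in A\cap \operatorname{Orb}_f(t): x\le X\}|}{|\{x\in\operatorname{Orb}_f(t): x\le X\}|},$$ provided this limit exists. A real number $\delta$ with $0\le\delta\le1$ is $(f,t,k)$-accessible if there is a system of arithmetic progressions $\{t+n_s\mathbb{Z}\}_{s=1}^k$ with positive integers $n_s$ such that $\delta_{f,t}\left(\bigcup_{s=1}^k(t+n_s\mathbb{Z})\right)=\delta$. -}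

module Defs where

open import Data.Nat as ℕ using (ℕ; zero; suc)
open import Data.Nat.Primality using (Prime)
open import Data.Integer as ℤ using (ℤ; +_)
open import Data.Integer.Divisibility using () renaming (_∣_ to _∣ℤ_)
open import Data.Rational as ℚ using (ℚ; 0ℚ; 1ℚ)
open import Data.Fin using (Fin; toℕ)
open import Data.List using (List; []; _∷_; length)
open import Data.List.Membership.Propositional using (_∈_)
open import Data.List.Relation.Unary.Unique.Propositional using (Unique)
open import Data.Product using (Σ; ∃; ∃-syntax; _×_; _,_)
open import Relation.Binary.PropositionalEquality using (_≡_)
open import Relation.Nullary using (¬_)
open import Function.Bundles using (_⇔_)

sumFin : (n : ℕ) → (Fin n → ℤ) → ℤ
sumFin zero    g = + 0
sumFin (suc n) g = g Fin.zero ℤ.+ sumFin n (λ i → g (Fin.suc i))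
  where import Data.Fin as Fin

evalPoly : {d : ℕ} → (Fin (suc d) → ℤ) → ℤ → ℤ
evalPoly {d} c x = sumFin (suc d) (λ i → c i ℤ.* (x ℤ.^ toℕ i))

iter : (ℤ → ℤ) → ℕ → ℤ → ℤ
iter f zero    x = x
iter f (suc n) x = f (iter f n x)

InOrb : (ℤ → ℤ) → ℤ → ℤ → Set
InOrb f t x = ∃[ n ] (iter f n t ≡ x)

FiniteSet : (ℤ → Set) → Set
FiniteSet S = ∃[ l ] (∀ x → (x ∈ l) ⇔ S x)

HasCard : (ℤ → Set) → ℕ → Set
HasCard S m = Σ (List ℤ) λ l → Unique l × (∀ x → (x ∈ l) ⇔ S x) × length l ≡ m

Wandering : (ℤ → ℤ) → ℤ → Set
Wandering f t = ¬ FiniteSet (InOrb f t)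

-- Real numbers (Bishop): regular sequences of rationals,
-- |x_m - x_n| ≤ 1/(m+1) + 1/(n+1).

inv : ℕ → ℚ
inv n = + 1 ℚ./ suc n

record ℝ : Set where
  field
    seq     : ℕ → ℚ
    regular : ∀ m n → ℚ.∣ seq m ℚ.- seq n ∣ ℚ.≤ inv m ℚ.+ inv n
open ℝ public

_<ℝ_ : ℚ → ℝ → Set
q <ℝ x = ∃[ n ] (inv n ℚ.< seq x n ℚ.- q)

_ℝ<_ : ℝ → ℚ → Set
x ℝ< q = ∃[ n ] (inv n ℚ.< q ℚ.- seq x n)

DistLe : ℚ → ℝ → ℚ → Set
DistLe q x ε = ∀ n → ℚ.∣ q ℚ.- seq x n ∣ ℚ.≤ ε ℚ.+ inv n

-- Natural density along an orbit:
-- δ_{f,t}(A) = lim_{X→∞} #{x ∈ A ∩ Orb_f(t) : x ≤ X} / #{x ∈ Orb_f(t) : x ≤ X}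
-- exists and equals r.

OrbUpTo : (ℤ → ℤ) → ℤ → ℤ → ℤ → Set
OrbUpTo f t X x = InOrb f t x × x ℤ.≤ X

OrbInAUpTo : (ℤ → ℤ) → ℤ → (ℤ → Set) → ℤ → ℤ → Set
OrbInAUpTo f t A X x = A x × InOrb f t x × x ℤ.≤ X

DensityIs : (ℤ → ℤ) → ℤ → (ℤ → Set) → ℝ → Set
DensityIs f t A r =
  ∀ (j : ℕ) → ∃[ M ] ∀ (X : ℤ) → M ℤ.≤ X →
    Σ ℕ λ a → Σ ℕ λ b →
      HasCard (OrbInAUpTo f t A X) a × HasCard (OrbUpTo f t X) (suc b) ×
      DistLe ((+ a) ℚ./ suc b) r (inv j)

InAPUnion : (k : ℕ) → (Fin k → ℕ) → ℤ → ℤ → Set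
InAPUnion k ns t x = ∃[ s ] ((+ ns s) ∣ℤ (x ℤ.- t))

Accessible : (ℤ → ℤ) → ℤ → ℕ → ℝ → Set
Accessible f t k δ =
  Σ (Fin k → ℕ) λ ns → (∀ s → 1 ℕ.≤ ns s) × DensityIs f t (InAPUnion k ns t) δ

-- two-sided orbit of g(x) = x + a:  {t + n a : n ∈ ℤ}
InOrbPM : ℤ → ℤ → ℤ → Set
InOrbPM a t x = ∃[ n ] (x ≡ t ℤ.+ n ℤ.* a)

InOrbPMUnion : (k : ℕ) → (Fin k → ℤ) → ℤ → ℤ → Set
InOrbPMUnion k as t x = ∃[ i ] InOrbPM (as i) t x

-- p enumerates the primes in increasing order: p 0 = p_1 < p 1 = p_2 < …
IsPrimeEnumeration : (ℕ → ℕ) → Set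
IsPrimeEnumeration p =
  (∀ i → Prime (p i)) × (∀ i → p i ℕ.< p (suc i)) × (∀ q → Prime q → ∃[ i ] (p i ≡ q))

prodPrimes : (ℕ → ℕ) → ℕ → ℚ
prodPrimes p zero    = 1ℚ
prodPrimes p (suc k) = prodPrimes p k ℚ.* (1ℚ ℚ.- primeInv (p k))
  where
  primeInv : ℕ → ℚ
  primeInv zero    = 0ℚ
  primeInv (suc m) = + 1 ℚ./ suc m

deltaK : (ℕ → ℕ) → ℕ → ℚ
deltaK p k = 1ℚ ℚ.- prodPrimes p k

module Submission where

-- The orbit of t eventually increases to infinity: |f x| > |x| once |x| is large, t is
-- wandering, and the density hypothesis itself says that only finitely many orbit points
-- lie below any bound.  Since f preserves congruences, the times m at which the orbit
-- returns to t modulo n are the multiples of the least positive one.  So for each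
-- progression t + n_s ℤ either n_s divides f t - t, every orbit point lies in it and the
-- density is 1 > r, or every positive return time is divisible by a prime q_s.  In the
-- second case the indices m ≥ 1 divisible by no q_s give orbit points outside the union,
-- and in any window of whole periods they have density ∏_s (1 - 1/q_s), which is at least
-- ∏_{i ≤ k} (1 - 1/p_i).  As the orbit is eventually increasing, counting orbit points
-- up to X amounts to counting indices, so the density of the union is at most δ_k < r.

open import Defs
open import Data.Nat as ℕ using (ℕ; zero; suc; z≤n; s≤s; _+_; _*_; _∸_; _^_; _≤_; _<_; _≤?_; _<?_)
import Data.Nat.Properties as ℕP
open ℕP using (anyUpTo?)
open import Data.Nat.Induction using (<-rec)
import Data.Nat.Divisibility as ND
import Data.Nat.DivMod as ℕDM
open import Data.Nat.Primality using (Prime; prime[2]; euclidsLemma; prime⇒irreducible; prime⇒nonZero; prime⇒nonTrivial)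
open import Data.Nat.Primality.Factorisation using (factorise)
open import Data.Nat.Tactic.RingSolver as ℕSolver using ()
open import Data.Integer as ℤ using (ℤ; +_; ∣_∣)
import Data.Integer.Properties as ℤP
import Data.Integer.DivMod as ℤDM
open import Data.Integer.Divisibility.Signed as Sgn using (divides)
open import Data.Integer.Tactic.RingSolver as ℤSolver using ()
open import Data.Rational as ℚ using (0ℚ; 1ℚ; _/_; mkℚ; *≤*)
import Data.Rational.Properties as ℚP
import Data.Rational.Solver as ℚSolver
open import Data.Rational.Unnormalised as ℚᵘ using (mkℚᵘ)
import Data.Rational.Unnormalised.Properties as ℚᵘP
open import Data.Fin as Fin using (Fin; toℕ; fromℕ; inject₁)
import Data.Fin.Properties as FinP
open import Data.List using (List; []; _∷_; _++_; length; lookup; applyUpTo; map; upTo)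
import Data.List.Properties as LP
open import Data.List.Properties using (length-upTo)
open import Data.List.Relation.Unary.Unique.Propositional using (Unique)
open import Data.List.Relation.Unary.Unique.Propositional.Properties using (applyUpTo⁺₁)
open import Data.List.Relation.Unary.AllPairs using ([]; _∷_)
open import Data.List.Relation.Unary.All as AllP using (_∷_)
open import Data.Nat.ListAction using (sum; product)
open import Data.List.Membership.Propositional using (_∈_; _∉_)
open import Data.List.Membership.Propositional.Properties using (∈-applyUpTo⁺; ∈-applyUpTo⁻; ∈-upTo⁺; ∈-∃++; ∈-++⁻; ∈-++⁺ˡ; ∈-++⁺ʳ; ∈-map⁺)
open import Data.List.Membership.DecPropositional ℤ._≟_ using (_∈?_)
open import Data.List.Relation.Unary.Any as Any using (here; there)
import Data.List.Relation.Unary.Any.Properties as AnyP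
open import Data.Bool using (Bool; true; false; not; _∧_; _∨_)
import Data.Bool.Properties as BoolP
open import Data.Product using (Σ; ∃-syntax; _×_; _,_; proj₁; proj₂)
open import Data.Sum using (inj₁; inj₂)
open import Data.Empty using (⊥; ⊥-elim)
open import Relation.Binary.PropositionalEquality
open import Relation.Nullary using (¬_; Dec; yes; no; ¬?; does)
open import Relation.Nullary.Decidable as Dec using (decidable-stable)
open import Function using (_∘_; case_of_)
open import Function.Bundles using (_⇔_; mk⇔; Equivalence)

-- Congruences

infix 4 _≡_mod_

-- A record rather than a definition, so that x, y and k are recovered by unification.
record _≡_mod_ (x y k : ℤ) : Set where
  constructor congruent
  field
    divides-difference : k Sgn.∣ (x ℤ.- y)
open _≡_mod_ public

module _ {k : ℤ} where

  mod-refl : ∀ x → x ≡ x mod k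
  mod-refl x = congruent (subst (k Sgn.∣_) (sym (ℤP.+-inverseʳ x)) (divides (+ 0) refl))

  mod-sym : ∀ {x y} → x ≡ y mod k → y ≡ x mod k
  mod-sym {x} {y} (congruent k∣x-y) = congruent (subst (k Sgn.∣_) (negate-difference x y) (Sgn.∣m⇒∣-m k∣x-y))
    where
    negate-difference : ∀ x y → ℤ.- (x ℤ.- y) ≡ y ℤ.- x
    negate-difference = ℤSolver.solve-∀

  mod-trans : ∀ {x y z} → x ≡ y mod k → y ≡ z mod k → x ≡ z mod k
  mod-trans {x} {y} {z} (congruent p) (congruent q) = congruent (subst (k Sgn.∣_) (telescope x y z) (Sgn.∣m∣n⇒∣m+n p q))
    where
    telescope : ∀ x y z → (x ℤ.- y) ℤ.+ (y ℤ.- z) ≡ x ℤ.- z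
    telescope = ℤSolver.solve-∀

  mod-+ : ∀ {x y u v} → x ≡ y mod k → u ≡ v mod k → x ℤ.+ u ≡ y ℤ.+ v mod k
  mod-+ {x} {y} {u} {v} (congruent p) (congruent q) = congruent (subst (k Sgn.∣_) (regroup x y u v) (Sgn.∣m∣n⇒∣m+n p q))
    where
    regroup : ∀ x y u v → (x ℤ.- y) ℤ.+ (u ℤ.- v) ≡ (x ℤ.+ u) ℤ.- (y ℤ.+ v)
    regroup = ℤSolver.solve-∀

  mod-* : ∀ {x y u v} → x ≡ y mod k → u ≡ v mod k → x ℤ.* u ≡ y ℤ.* v mod k
  mod-* {x} {y} {u} {v} (congruent p) (congruent q) =
    congruent (subst (k Sgn.∣_) (regroup x y u v) (Sgn.∣m∣n⇒∣m+n (Sgn.∣n⇒∣m*n x q) (Sgn.∣n⇒∣m*n v p)))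
    where
    regroup : ∀ x y u v → x ℤ.* (u ℤ.- v) ℤ.+ v ℤ.* (x ℤ.- y) ≡ x ℤ.* u ℤ.- y ℤ.* v
    regroup = ℤSolver.solve-∀

  mod-^ : ∀ {x y} n → x ≡ y mod k → x ℤ.^ n ≡ y ℤ.^ n mod k
  mod-^ zero    x≡y = mod-refl (+ 1)
  mod-^ (suc n) x≡y = mod-* x≡y (mod-^ n x≡y)

  sumFin-mod : ∀ n {g h : Fin n → ℤ} → (∀ i → g i ≡ h i mod k) → sumFin n g ≡ sumFin n h mod k
  sumFin-mod zero    g≡h = mod-refl (+ 0)
  sumFin-mod (suc n) g≡h = mod-+ (g≡h Fin.zero) (sumFin-mod n (g≡h ∘ Fin.suc))

  evalPoly-mod : ∀ {d} (c : Fin (suc d) → ℤ) {x y} → x ≡ y mod k → evalPoly c x ≡ evalPoly c y mod k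
  evalPoly-mod {d} c x≡y = sumFin-mod (suc d) λ i → mod-* (mod-refl (c i)) (mod-^ (toℕ i) x≡y)

mod-0⇒≡ : ∀ {x y} → x ≡ y mod + 0 → x ≡ y
mod-0⇒≡ {x} {y} (congruent (divides q x-y≡q*0)) = ℤP.i-j≡0⇒i≡j x y (trans x-y≡q*0 (ℤP.*-zeroʳ q))

%ℕ-≡⇒mod : ∀ n .{{_ : ℕ.NonZero n}} x y → x ℤDM.%ℕ n ≡ y ℤDM.%ℕ n → x ≡ y mod + n
%ℕ-≡⇒mod n x y eq = congruent (divides (x ℤDM./ℕ n ℤ.- y ℤDM./ℕ n) (begin
  x ℤ.- y                                      ≡⟨ cong₂ ℤ._-_ (ℤDM.a≡a%ℕn+[a/ℕn]*n x n) (ℤDM.a≡a%ℕn+[a/ℕn]*n y n) ⟩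
  (+ r ℤ.+ x ℤDM./ℕ n ℤ.* + n) ℤ.- (+ s ℤ.+ y ℤDM./ℕ n ℤ.* + n) ≡⟨ cong (λ s → (+ r ℤ.+ x ℤDM./ℕ n ℤ.* + n) ℤ.- (+ s ℤ.+ y ℤDM./ℕ n ℤ.* + n)) (sym eq) ⟩
  (+ r ℤ.+ x ℤDM./ℕ n ℤ.* + n) ℤ.- (+ r ℤ.+ y ℤDM./ℕ n ℤ.* + n) ≡⟨ cancel-remainder (+ r) (x ℤDM./ℕ n) (y ℤDM./ℕ n) (+ n) ⟩
  (x ℤDM./ℕ n ℤ.- y ℤDM./ℕ n) ℤ.* + n          ∎))
  where
  open ≡-Reasoning
  r = x ℤDM.%ℕ n
  s = y ℤDM.%ℕ n
  cancel-remainder : ∀ r a b n → (r ℤ.+ a ℤ.* n) ℤ.- (r ℤ.+ b ℤ.* n) ≡ (a ℤ.- b) ℤ.* n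
  cancel-remainder = ℤSolver.solve-∀

-- Finite combinatorics

least-witness : ∀ {P : ℕ → Set} → (∀ n → Dec (P n)) → ∀ {n} → P n → ∃[ m ] (P m × ∀ k → k < m → ¬ P k)
least-witness {P} P? {n} = <-rec (λ n → P n → ∃[ m ] (P m × ∀ k → k < m → ¬ P k)) step n
  where
  step : ∀ n → (∀ {k} → k < n → P k → ∃[ m ] (P m × ∀ k → k < m → ¬ P k)) → P n → ∃[ m ] (P m × ∀ k → k < m → ¬ P k)
  step n rec Pn with anyUpTo? P? n
  ... | yes (k , k<n , Pk) = rec k<n Pk
  ... | no ∄k = n , Pn , λ k k<n Pk → ∄k (k , k<n , Pk)

∃prime∣ : ∀ {n} → 2 ≤ n → ∃[ q ] (Prime q × q ND.∣ n)
∃prime∣ {n@(suc (suc _))} (s≤s (s≤s z≤n)) with factorise n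
... | record { factors = [] ; isFactorisation = () }
... | record { factors = q ∷ qs ; isFactorisation = n≡∏ ; factorsPrime = q-prime ∷ _ } =
  q , q-prime , subst (q ND.∣_) (sym n≡∏) (ND.m∣m*n (product qs))

pigeonhole-list : ∀ {A : Set} (a : ℕ → A) (l : List A) → (∀ n → n ≤ length l → a n ∈ l) →
  ∃[ i ] ∃[ j ] (i < j × j ≤ length l × a i ≡ a j)
pigeonhole-list a l a∈l = toℕ i , toℕ j , i<j , ℕP.≤-pred (FinP.toℕ<n j) , (begin
  a (toℕ i)                  ≡⟨ AnyP.lookup-index (a∈l′ i) ⟩
  lookup l (position i)      ≡⟨ cong (lookup l) same-position ⟩
  lookup l (position j)      ≡⟨ sym (AnyP.lookup-index (a∈l′ j)) ⟩
  a (toℕ j)                  ∎)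
  where
  open ≡-Reasoning
  a∈l′ : ∀ i → a (toℕ i) ∈ l
  a∈l′ i = a∈l (toℕ i) (ℕP.≤-pred (FinP.toℕ<n i))
  position : Fin (suc (length l)) → Fin (length l)
  position i = Any.index (a∈l′ i)
  collision = FinP.pigeonhole ℕP.≤-refl position
  i = proj₁ collision
  j = proj₁ (proj₂ collision)
  i<j = proj₁ (proj₂ (proj₂ collision))
  same-position = proj₂ (proj₂ (proj₂ collision))

unique⊆⇒length≤ : ∀ {A : Set} {xs ys : List A} → Unique xs → (∀ {x} → x ∈ xs → x ∈ ys) → length xs ≤ length ys
unique⊆⇒length≤ {xs = []}     _            _  = z≤n
unique⊆⇒length≤ {xs = x ∷ xs} (x∉xs ∷ uniq) xs⊆ys with ∈-∃++ (xs⊆ys (here refl))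
... | zs , ws , refl = begin
  suc (length xs)          ≤⟨ s≤s (unique⊆⇒length≤ uniq xs⊆zs++ws) ⟩
  suc (length (zs ++ ws))  ≡⟨ cong suc (LP.length-++ zs) ⟩
  suc (length zs + length ws) ≡⟨ sym (ℕP.+-suc (length zs) (length ws)) ⟩
  length zs + suc (length ws) ≡⟨ sym (LP.length-++ zs) ⟩
  length (zs ++ x ∷ ws)    ∎
  where
  open ℕP.≤-Reasoning
  xs⊆zs++ws : ∀ {y} → y ∈ xs → y ∈ zs ++ ws
  xs⊆zs++ws {y} y∈xs with ∈-++⁻ zs (xs⊆ys (there y∈xs))
  ... | inj₁ y∈zs         = ∈-++⁺ˡ y∈zs
  ... | inj₂ (here refl)  = ⊥-elim (AllP.lookup x∉xs y∈xs refl)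
  ... | inj₂ (there y∈ws) = ∈-++⁺ʳ zs y∈ws

-- Polynomials grow outside a bounded set

i≤+∣i∣ : ∀ i → i ℤ.≤ + ∣ i ∣
i≤+∣i∣ (+ n)     = ℤP.≤-refl
i≤+∣i∣ ℤ.-[1+ n ] = ℤ.-≤+

+≤i⇒≤∣i∣ : ∀ {m i} → + m ℤ.≤ i → m ≤ ∣ i ∣
+≤i⇒≤∣i∣ (ℤ.+≤+ m≤n) = m≤n

∣i∣<∣j∣⇒i<j : ∀ {i j} → + 0 ℤ.≤ i → + 0 ℤ.≤ j → ∣ i ∣ < ∣ j ∣ → i ℤ.< j
∣i∣<∣j∣⇒i<j (ℤ.+≤+ _) (ℤ.+≤+ _) = ℤ.+<+

∣x∣≤sum∣l∣ : ∀ {x} l → x ∈ l → ∣ x ∣ ≤ sum (map ∣_∣ l)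
∣x∣≤sum∣l∣ (y ∷ l) (here refl) = ℕP.m≤m+n ∣ y ∣ _
∣x∣≤sum∣l∣ (y ∷ l) (there x∈l) = ℕP.≤-trans (∣x∣≤sum∣l∣ l x∈l) (ℕP.m≤n+m _ ∣ y ∣)

sumFinℕ : (n : ℕ) → (Fin n → ℕ) → ℕ
sumFinℕ zero    g = 0
sumFinℕ (suc n) g = g Fin.zero + sumFinℕ n (g ∘ Fin.suc)

sumFinℕ-mono-≤ : ∀ n {g h : Fin n → ℕ} → (∀ i → g i ≤ h i) → sumFinℕ n g ≤ sumFinℕ n h
sumFinℕ-mono-≤ zero    le = z≤n
sumFinℕ-mono-≤ (suc n) le = ℕP.+-mono-≤ (le Fin.zero) (sumFinℕ-mono-≤ n (le ∘ Fin.suc))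

sumFinℕ-*ʳ : ∀ n (g : Fin n → ℕ) u → sumFinℕ n (λ i → g i * u) ≡ sumFinℕ n g * u
sumFinℕ-*ʳ zero    g u = refl
sumFinℕ-*ʳ (suc n) g u =
  trans (cong (λ s → g Fin.zero * u + s) (sumFinℕ-*ʳ n (g ∘ Fin.suc) u)) (sym (ℕP.*-distribʳ-+ u (g Fin.zero) _))

sumFin-last : ∀ n (g : Fin (suc n) → ℤ) → sumFin (suc n) g ≡ sumFin n (g ∘ inject₁) ℤ.+ g (fromℕ n)
sumFin-last zero    g = trans (ℤP.+-identityʳ (g Fin.zero)) (sym (ℤP.+-identityˡ _))
sumFin-last (suc n) g =
  trans (cong (λ s → g Fin.zero ℤ.+ s) (sumFin-last n (g ∘ Fin.suc))) (sym (ℤP.+-assoc (g Fin.zero) _ _))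

∣sumFin∣≤sumFinℕ∣∣ : ∀ n (g : Fin n → ℤ) → ∣ sumFin n g ∣ ≤ sumFinℕ n (λ i → ∣ g i ∣)
∣sumFin∣≤sumFinℕ∣∣ zero    g = z≤n
∣sumFin∣≤sumFinℕ∣∣ (suc n) g = ℕP.≤-trans (ℤP.∣i+j∣≤∣i∣+∣j∣ (g Fin.zero) _)
  (ℕP.+-monoʳ-≤ ∣ g Fin.zero ∣ (∣sumFin∣≤sumFinℕ∣∣ n (g ∘ Fin.suc)))

∣i^n∣≡∣i∣^n : ∀ i n → ∣ i ℤ.^ n ∣ ≡ ∣ i ∣ ^ n
∣i^n∣≡∣i∣^n i zero    = refl
∣i^n∣≡∣i∣^n i (suc n) = trans (ℤP.abs-* i (i ℤ.^ n)) (cong (∣ i ∣ *_) (∣i^n∣≡∣i∣^n i n))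

∣j∣∸∣i∣≤∣i+j∣ : ∀ i j → ∣ j ∣ ∸ ∣ i ∣ ≤ ∣ i ℤ.+ j ∣
∣j∣∸∣i∣≤∣i+j∣ i j = ℕP.m≤n+o⇒m∸n≤o ∣ j ∣ ∣ i ∣ (begin
  ∣ j ∣                   ≡⟨ cong ∣_∣ (sym (i+j-i≡j i j)) ⟩
  ∣ i ℤ.+ j ℤ.- i ∣       ≤⟨ ℤP.∣i-j∣≤∣i∣+∣j∣ (i ℤ.+ j) i ⟩
  ∣ i ℤ.+ j ∣ + ∣ i ∣     ≡⟨ ℕP.+-comm ∣ i ℤ.+ j ∣ ∣ i ∣ ⟩
  ∣ i ∣ + ∣ i ℤ.+ j ∣     ∎)
  where
  open ℕP.≤-Reasoning
  i+j-i≡j : ∀ i j → i ℤ.+ j ℤ.- i ≡ j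
  i+j-i≡j = ℤSolver.solve-∀

module Monomials {d} (c : Fin (suc d) → ℤ) (x : ℤ) where

  monomial : Fin (suc d) → ℤ
  monomial i = c i ℤ.* x ℤ.^ toℕ i

  lower-terms : ℤ
  lower-terms = sumFin d (monomial ∘ inject₁)

  evalPoly≡lower+leading : evalPoly c x ≡ lower-terms ℤ.+ monomial (fromℕ d)
  evalPoly≡lower+leading = sumFin-last d monomial

  ∣monomial∣ : ∀ i → ∣ monomial i ∣ ≡ ∣ c i ∣ * ∣ x ∣ ^ toℕ i
  ∣monomial∣ i = trans (ℤP.abs-* (c i) _) (cong (∣ c i ∣ *_) (∣i^n∣≡∣i∣^n x (toℕ i)))

  ∣leading∣≥ : c (fromℕ d) ≢ + 0 → ∣ x ∣ ^ d ≤ ∣ monomial (fromℕ d) ∣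
  ∣leading∣≥ c-lead≢0 = begin
    ∣ x ∣ ^ d                                 ≡⟨ sym (ℕP.*-identityˡ _) ⟩
    1 * ∣ x ∣ ^ d                             ≤⟨ ℕP.*-monoˡ-≤ _ (ℕP.n≢0⇒n>0 (c-lead≢0 ∘ ℤP.∣i∣≡0⇒i≡0)) ⟩
    ∣ c (fromℕ d) ∣ * ∣ x ∣ ^ d               ≡⟨ cong (λ n → ∣ c (fromℕ d) ∣ * ∣ x ∣ ^ n) (sym (FinP.toℕ-fromℕ d)) ⟩
    ∣ c (fromℕ d) ∣ * ∣ x ∣ ^ toℕ (fromℕ d)   ≡⟨ sym (∣monomial∣ (fromℕ d)) ⟩
    ∣ monomial (fromℕ d) ∣                    ∎
    where open ℕP.≤-Reasoning

  ∣lower-terms∣≤ : .{{_ : ℕ.NonZero ∣ x ∣}} → ∣ lower-terms ∣ ≤ sumFinℕ d (λ i → ∣ c (inject₁ i) ∣) * ∣ x ∣ ^ ℕ.pred d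
  ∣lower-terms∣≤ = begin
    ∣ lower-terms ∣                                      ≤⟨ ∣sumFin∣≤sumFinℕ∣∣ d (monomial ∘ inject₁) ⟩
    sumFinℕ d (λ i → ∣ monomial (inject₁ i) ∣)           ≤⟨ sumFinℕ-mono-≤ d monomial-≤ ⟩
    sumFinℕ d (λ i → ∣ c (inject₁ i) ∣ * ∣ x ∣ ^ ℕ.pred d) ≡⟨ sumFinℕ-*ʳ d (λ i → ∣ c (inject₁ i) ∣) _ ⟩
    sumFinℕ d (λ i → ∣ c (inject₁ i) ∣) * ∣ x ∣ ^ ℕ.pred d ∎
    where
    open ℕP.≤-Reasoning
    monomial-≤ : ∀ i → ∣ monomial (inject₁ i) ∣ ≤ ∣ c (inject₁ i) ∣ * ∣ x ∣ ^ ℕ.pred d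
    monomial-≤ i = ℕP.≤-trans (ℕP.≤-reflexive (∣monomial∣ (inject₁ i)))
      (ℕP.*-monoʳ-≤ ∣ c (inject₁ i) ∣ (ℕP.^-monoʳ-≤ ∣ x ∣
        (ℕP.≤-trans (ℕP.≤-reflexive (FinP.toℕ-inject₁ i)) (ℕP.<⇒≤pred (FinP.toℕ<n i)))))

evalPoly-escapes : ∀ {d} → 2 ≤ d → (c : Fin (suc d) → ℤ) → c (fromℕ d) ≢ + 0 →
  ∃[ B ] ∀ x → B ≤ ∣ x ∣ → suc ∣ x ∣ ≤ ∣ evalPoly c x ∣
evalPoly-escapes {d@(suc (suc e))} (s≤s (s≤s z≤n)) c c-lead≢0 = S + 2 , escapes
  where
  S = sumFinℕ d (λ i → ∣ c (inject₁ i) ∣)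

  escapes : ∀ x → S + 2 ≤ ∣ x ∣ → suc ∣ x ∣ ≤ ∣ evalPoly c x ∣
  escapes x S+2≤u = begin
    suc u                                   ≤⟨ ℕP.+-monoˡ-≤ u 1≤u ⟩
    u + u                                   ≤⟨ ℕP.+-mono-≤ u≤U u≤U ⟩
    U + U                                   ≡⟨ cong (λ n → U + n) (sym (ℕP.+-identityʳ U)) ⟩
    2 * U                                   ≤⟨ ℕP.*-monoˡ-≤ U (ℕP.m+n≤o⇒m≤o∸n 2 (ℕP.≤-trans (ℕP.≤-reflexive (ℕP.+-comm 2 S)) S+2≤u)) ⟩
    (u ∸ S) * U                             ≡⟨ ℕP.*-distribʳ-∸ U u S ⟩
    u * U ∸ S * U                           ≤⟨ ℕP.∸-mono (∣leading∣≥ c-lead≢0) ∣lower-terms∣≤ ⟩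
    ∣ monomial (fromℕ d) ∣ ∸ ∣ lower-terms ∣ ≤⟨ ∣j∣∸∣i∣≤∣i+j∣ lower-terms (monomial (fromℕ d)) ⟩
    ∣ lower-terms ℤ.+ monomial (fromℕ d) ∣   ≡⟨ cong ∣_∣ (sym evalPoly≡lower+leading) ⟩
    ∣ evalPoly c x ∣                        ∎
    where
    open ℕP.≤-Reasoning
    open Monomials c x
    u = ∣ x ∣
    U = u ^ suc e
    1≤u : 1 ≤ u
    1≤u = ℕP.≤-trans (ℕP.m≤n+m 1 (S + 1)) (ℕP.≤-trans (ℕP.≤-reflexive (ℕP.+-assoc S 1 1)) S+2≤u)
    instance
      u≢0 : ℕ.NonZero u
      u≢0 = ℕ.>-nonZero 1≤u
    u≤U : u ≤ U
    u≤U = ℕP.≤-trans (ℕP.≤-reflexive (sym (ℕP.*-identityʳ u))) (ℕP.*-monoʳ-≤ u (ℕP.^-monoʳ-≤ u {0} {e} z≤n))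

-- Orbits

module StrictlyIncreasingFrom (a : ℕ → ℤ) (N : ℕ) (step : ∀ n → N ≤ n → a n ℤ.< a (suc n)) where

  <-mono : ∀ {m n} → N ≤ m → m < n → a m ℤ.< a n
  <-mono {m} {suc n} N≤m (s≤s m≤n) with ℕP.m≤n⇒m<n∨m≡n m≤n
  ... | inj₁ m<n = ℤP.<-trans (<-mono N≤m m<n) (step n (ℕP.≤-trans N≤m (ℕP.<⇒≤ m<n)))
  ... | inj₂ refl = step m N≤m

  ≤-mono : ∀ {m n} → N ≤ m → m ≤ n → a m ℤ.≤ a n
  ≤-mono N≤m m≤n with ℕP.m≤n⇒m<n∨m≡n m≤n
  ... | inj₁ m<n = ℤP.<⇒≤ (<-mono N≤m m<n)
  ... | inj₂ refl = ℤP.≤-refl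

  ≤-reflect : ∀ {m n} → N ≤ n → a m ℤ.≤ a n → m ≤ n
  ≤-reflect {m} {n} N≤n am≤an with m ≤? n
  ... | yes m≤n = m≤n
  ... | no m≰n = ⊥-elim (ℤP.<⇒≱ (<-mono N≤n (ℕP.≰⇒> m≰n)) am≤an)

  injective : ∀ {m n} → N ≤ m → N ≤ n → a m ≡ a n → m ≡ n
  injective N≤m N≤n eq = ℕP.≤-antisym (≤-reflect N≤n (ℤP.≤-reflexive eq)) (≤-reflect N≤m (ℤP.≤-reflexive (sym eq)))

  index<value : + 0 ℤ.< a N → ∀ i → + i ℤ.< a (i + N)
  index<value 0<aN zero    = 0<aN
  index<value 0<aN (suc i) = ℤP.≤-<-trans (ℤP.i<j⇒suc[i]≤j (index<value 0<aN i)) (step (i + N) (ℕP.m≤n+m N i))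

iter-+ : ∀ (f : ℤ → ℤ) m n x → iter f (m + n) x ≡ iter f m (iter f n x)
iter-+ f zero    n x = refl
iter-+ f (suc m) n x = cong f (iter-+ f m n x)

module Orbit (f : ℤ → ℤ) (t : ℤ) where

  orbit : ℕ → ℤ
  orbit n = iter f n t

  repetition⇒finite : ∀ {i j} → i < j → orbit i ≡ orbit j → FiniteSet (InOrb f t)
  repetition⇒finite {i} {j} i<j orbit-i≡orbit-j =
    applyUpTo orbit j , λ x → mk⇔ (from-list x) (to-list x)
    where
    early-representative : ∀ n → ∃[ m ] (m < j × orbit m ≡ orbit n)
    early-representative = <-rec _ step
      where
      step : ∀ n → (∀ {m} → m < n → ∃[ m' ] (m' < j × orbit m' ≡ orbit m)) → ∃[ m ] (m < j × orbit m ≡ orbit n)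
      step n rec with n <? j
      ... | yes n<j = n , n<j , refl
      ... | no n≮j with rec {n ∸ j + i} (ℕP.≤-trans (ℕP.+-monoʳ-< (n ∸ j) i<j) (ℕP.≤-reflexive n∸j+j≡n))
        where
        n∸j+j≡n = ℕP.m∸n+n≡m (ℕP.≮⇒≥ n≮j)
      ... | m , m<j , eq = m , m<j , (begin
        orbit m               ≡⟨ eq ⟩
        orbit (n ∸ j + i)     ≡⟨ iter-+ f (n ∸ j) i t ⟩
        iter f (n ∸ j) (orbit i) ≡⟨ cong (iter f (n ∸ j)) orbit-i≡orbit-j ⟩
        iter f (n ∸ j) (orbit j) ≡⟨ sym (iter-+ f (n ∸ j) j t) ⟩
        orbit (n ∸ j + j)     ≡⟨ cong orbit (ℕP.m∸n+n≡m (ℕP.≮⇒≥ n≮j)) ⟩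
        orbit n               ∎)
        where open ≡-Reasoning
    from-list : ∀ x → x ∈ applyUpTo orbit j → InOrb f t x
    from-list x x∈ with ∈-applyUpTo⁻ orbit x∈
    ... | m , _ , refl = m , refl
    to-list : ∀ x → InOrb f t x → x ∈ applyUpTo orbit j
    to-list x (n , refl) with early-representative n
    ... | m , m<j , eq = subst (_∈ applyUpTo orbit j) eq (∈-applyUpTo⁺ orbit m<j)

  wandering⇒∃∉ : Wandering f t → (l : List ℤ) → ∃[ n ] orbit n ∉ l
  wandering⇒∃∉ wandering l with anyUpTo? (λ n → ¬? (orbit n ∈? l)) (suc (length l))
  ... | yes (n , _ , orbit-n∉l) = n , orbit-n∉l
  ... | no ¬∃ with pigeonhole-list orbit l (λ n n≤L → decidable-stable (orbit n ∈? l) λ ∉l → ¬∃ (n , s≤s n≤L , ∉l))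
  ...   | i , j , i<j , _ , eq = ⊥-elim (wandering (repetition⇒finite i<j eq))

  module _ (B : ℕ) (grows : ∀ x → B ≤ ∣ x ∣ → suc ∣ x ∣ ≤ ∣ f x ∣) where

    ∣orbit∣-grows : ∀ {N} → B ≤ ∣ orbit N ∣ → ∀ i → B + i ≤ ∣ orbit (i + N) ∣
    ∣orbit∣-grows B≤ zero    = ℕP.≤-trans (ℕP.≤-reflexive (ℕP.+-identityʳ B)) B≤
    ∣orbit∣-grows B≤ (suc i) = ℕP.≤-trans (ℕP.≤-reflexive (ℕP.+-suc B i))
      (ℕP.≤-trans (s≤s (∣orbit∣-grows B≤ i)) (grows _ (ℕP.≤-trans (ℕP.m≤m+n B i) (∣orbit∣-grows B≤ i))))

    eventually-above-and-increasing : Wandering f t → ∀ X → + B ℤ.≤ X → (l : List ℤ) →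
      (∀ n → orbit n ℤ.≤ X → orbit n ∈ l) →
      ∃[ N ] ((∀ n → N ≤ n → X ℤ.< orbit n) × (∀ n → N ≤ n → orbit n ℤ.< orbit (suc n)))
    eventually-above-and-increasing wandering X B≤X l covers = N , above , increasing
      where
      N₀ = proj₁ (wandering⇒∃∉ wandering l)
      orbit-N₀∉l = proj₂ (wandering⇒∃∉ wandering l)
      V = sum (map ∣_∣ l)
      N = suc V + N₀

      ∉l⇒above : ∀ {n} → orbit n ∉ l → X ℤ.< orbit n
      ∉l⇒above {n} ∉l with orbit n ℤ.≤? X
      ... | yes ≤X = ⊥-elim (∉l (covers n ≤X))
      ... | no ≰X = ℤP.≰⇒> ≰X

      B≤∣orbit-N₀∣ : B ≤ ∣ orbit N₀ ∣
      B≤∣orbit-N₀∣ = +≤i⇒≤∣i∣ (ℤP.<⇒≤ (ℤP.≤-<-trans B≤X (∉l⇒above {N₀} orbit-N₀∉l)))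

      V<∣orbit∣ : ∀ n → N ≤ n → V < ∣ orbit n ∣
      V<∣orbit∣ n N≤n = begin-strict
        V                           <⟨ ℕP.m+n≤o⇒m≤o∸n (suc V) N≤n ⟩
        n ∸ N₀                      ≤⟨ ℕP.m≤n+m (n ∸ N₀) B ⟩
        B + (n ∸ N₀)                ≤⟨ ∣orbit∣-grows {N₀} B≤∣orbit-N₀∣ (n ∸ N₀) ⟩
        ∣ orbit (n ∸ N₀ + N₀) ∣     ≡⟨ cong (∣_∣ ∘ orbit) (ℕP.m∸n+n≡m (ℕP.≤-trans (ℕP.m≤n+m N₀ (suc V)) N≤n)) ⟩
        ∣ orbit n ∣                 ∎
        where open ℕP.≤-Reasoning

      above : ∀ n → N ≤ n → X ℤ.< orbit n
      above n N≤n = ∉l⇒above {n} λ ∈l → ℕP.<⇒≱ (V<∣orbit∣ n N≤n) (∣x∣≤sum∣l∣ l ∈l)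

      increasing : ∀ n → N ≤ n → orbit n ℤ.< orbit (suc n)
      increasing n N≤n = ∣i∣<∣j∣⇒i<j (positive n N≤n) (positive (suc n) (ℕP.m≤n⇒m≤1+n N≤n))
        (grows (orbit n) (+≤i⇒≤∣i∣ (ℤP.<⇒≤ (ℤP.≤-<-trans B≤X (above n N≤n)))))
        where
        positive : ∀ n → N ≤ n → + 0 ℤ.≤ orbit n
        positive n N≤n = ℤP.<⇒≤ (ℤP.≤-<-trans (ℤP.≤-trans (ℤ.+≤+ z≤n) B≤X) (above n N≤n))

-- Return times modulo n

module OrbitModulo (f : ℤ → ℤ) (f-mod : ∀ {k x y} → x ≡ y mod k → f x ≡ f y mod k) (t : ℤ) where
  open Orbit f t

  iter-mod : ∀ {k x y} m → x ≡ y mod k → iter f m x ≡ iter f m y mod k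
  iter-mod zero    x≡y = x≡y
  iter-mod (suc m) x≡y = f-mod (iter-mod m x≡y)

  orbit-shift-mod : ∀ {k i j} m → orbit i ≡ orbit j mod k → orbit (m + i) ≡ orbit (m + j) mod k
  orbit-shift-mod {k} {i} {j} m eq =
    subst₂ (λ a b → a ≡ b mod k) (sym (iter-+ f m i t)) (sym (iter-+ f m j t)) (iter-mod m eq)

  Returns : ℕ → ℕ → Set
  Returns n m = orbit m ≡ t mod + n

  returns? : ∀ n m → Dec (Returns n m)
  returns? n m = Dec.map′ congruent divides-difference (+ n Sgn.∣? (orbit m ℤ.- t))

  returns-at-1⇒always : ∀ {n} → Returns n 1 → ∀ m → Returns n m
  returns-at-1⇒always r₁ zero    = mod-refl t
  returns-at-1⇒always r₁ (suc m) = mod-trans (f-mod (returns-at-1⇒always r₁ m)) r₁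

  returns-multiples : ∀ {n ℓ} → Returns n ℓ → ∀ q → Returns n (q * ℓ)
  returns-multiples r zero    = mod-refl t
  returns-multiples {n} {ℓ} r (suc q) =
    mod-trans (subst₂ (λ i j → orbit i ≡ orbit j mod + n) (ℕP.+-comm (q * ℓ) ℓ) (ℕP.+-identityʳ (q * ℓ))
                (orbit-shift-mod {j = 0} (q * ℓ) r))
              (returns-multiples r q)

  -- Modulo n the orbit repeats among its first n + 1 points, so a return can be moved into [1, n].
  return-within-modulus : ∀ {n} .{{_ : ℕ.NonZero n}} {m} → 1 ≤ m → Returns n m → ∃[ m' ] (1 ≤ m' × m' ≤ n × Returns n m')
  return-within-modulus {n} {m} = <-rec (λ m → 1 ≤ m → Returns n m → ∃[ m' ] (1 ≤ m' × m' ≤ n × Returns n m')) step m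
    where
    step : ∀ m → (∀ {k} → k < m → 1 ≤ k → Returns n k → ∃[ m' ] (1 ≤ m' × m' ≤ n × Returns n m')) →
      1 ≤ m → Returns n m → ∃[ m' ] (1 ≤ m' × m' ≤ n × Returns n m')
    step m rec 1≤m r with m ≤? n
    ... | yes m≤n = m , 1≤m , m≤n , r
    ... | no m≰n with pigeonhole-list (λ i → orbit i ℤDM.%ℕ n) (upTo n) (λ i _ → ∈-upTo⁺ (ℤDM.n%ℕd<d (orbit i) n))
    ...   | i , j , i<j , j≤n , same-residue = rec m'<m 1≤m' (mod-trans orbit-m'≡orbit-m r)
      where
      j<m : j < m
      j<m = ℕP.≤-<-trans (ℕP.≤-trans j≤n (ℕP.≤-reflexive (length-upTo n))) (ℕP.≰⇒> m≰n)
      m∸j+j≡m = ℕP.m∸n+n≡m (ℕP.<⇒≤ j<m)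
      m' = m ∸ j + i
      m'<m : m' < m
      m'<m = ℕP.≤-trans (ℕP.+-monoʳ-< (m ∸ j) i<j) (ℕP.≤-reflexive m∸j+j≡m)
      1≤m' : 1 ≤ m'
      1≤m' = ℕP.≤-trans (ℕP.m<n⇒0<n∸m j<m) (ℕP.m≤m+n (m ∸ j) i)
      orbit-m'≡orbit-m : orbit m' ≡ orbit m mod + n
      orbit-m'≡orbit-m = subst (λ k → orbit m' ≡ orbit k mod + n) m∸j+j≡m
        (orbit-shift-mod (m ∸ j) (%ℕ-≡⇒mod n (orbit i) (orbit j) same-residue))

  returns⇒least-return∣ : ∀ {n ℓ} → Returns n (suc ℓ) → (∀ k → k < ℓ → ¬ Returns n (suc k)) →
    ∀ m → Returns n m → suc ℓ ND.∣ m
  returns⇒least-return∣ {n} {ℓ} rℓ minimal m r with m ℕ.% suc ℓ in m%ℓ≡r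
  ... | zero   = ND.m%n≡0⇒n∣m m (suc ℓ) m%ℓ≡r
  ... | suc k = ⊥-elim (minimal k k<ℓ (mod-trans orbit-r≡orbit-m r))
    where
    k<ℓ : k < ℓ
    k<ℓ = ℕP.≤-pred (subst (_< suc ℓ) m%ℓ≡r (ℕDM.m%n<n m (suc ℓ)))
    multiple = m ℕ./ suc ℓ * suc ℓ
    m≡r+multiple : suc k + multiple ≡ m
    m≡r+multiple = trans (cong (_+ multiple) (sym m%ℓ≡r)) (sym (ℕDM.m≡m%n+[m/n]*n m (suc ℓ)))
    orbit-r≡orbit-m : orbit (suc k) ≡ orbit m mod + n
    orbit-r≡orbit-m = subst₂ (λ i j → orbit i ≡ orbit j mod + n) (ℕP.+-identityʳ (suc k)) m≡r+multiple
      (mod-sym (orbit-shift-mod (suc k) (returns-multiples rℓ (m ℕ./ suc ℓ))))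

  -- The least positive return time is at least 2 and divides all others; if the orbit
  -- never returns, any prime will do.
  prime-divides-return-times : Wandering f t → ∀ n → ¬ Returns n 1 →
    ∃[ q ] (Prime q × ∀ m → 1 ≤ m → Returns n m → q ND.∣ m)
  prime-divides-return-times wandering zero ¬r₁ =
    2 , prime[2] , λ m 1≤m r → ⊥-elim (wandering (repetition⇒finite 1≤m (sym (mod-0⇒≡ r))))
  prime-divides-return-times wandering n@(suc _) ¬r₁ with anyUpTo? (λ k → returns? n (suc k)) n
  ... | no ∄early-return = 2 , prime[2] , λ m 1≤m r → ⊥-elim (case return-within-modulus {m = m} 1≤m r of λ where
    (suc m' , _ , m'<n , r') → ∄early-return (m' , m'<n , r'))
  ... | yes (k , _ , r) with least-witness (λ k → returns? n (suc k)) {k} r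
  ...   | zero , r₁ , _ = ⊥-elim (¬r₁ r₁)
  ...   | ℓ@(suc _) , rℓ , minimal with ∃prime∣ {suc ℓ} (s≤s (s≤s z≤n))
  ...     | q , q-prime , q∣ℓ = q , q-prime , λ m _ r → ND.∣-trans q∣ℓ (returns⇒least-return∣ rℓ minimal m r)

-- Counting in intervals

bit : Bool → ℕ
bit true  = 1
bit false = 0

count : (ℕ → Bool) → ℕ → ℕ → ℕ
count g a zero    = 0
count g a (suc L) = bit (g a) + count g (suc a) L

module _ where
  private
    interchange : ∀ a b c d → (a + b) + (c + d) ≡ (a + c) + (b + d)
    interchange = ℕSolver.solve-∀

  count-cong : ∀ L {g h a b} → (∀ i → i < L → g (i + a) ≡ h (i + b)) → count g a L ≡ count h b L
  count-cong zero    eq = refl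
  count-cong (suc L) {g} {h} {a} {b} eq = cong₂ _+_ (cong bit (eq 0 (s≤s z≤n)))
    (count-cong L λ i i<L → subst₂ (λ x y → g x ≡ h y) (sym (ℕP.+-suc i a)) (sym (ℕP.+-suc i b)) (eq (suc i) (s≤s i<L)))

  count-++ : ∀ g a L₁ L₂ → count g a (L₁ + L₂) ≡ count g a L₁ + count g (L₁ + a) L₂
  count-++ g a zero     L₂ = refl
  count-++ g a (suc L₁) L₂ = begin
    bit (g a) + count g (suc a) (L₁ + L₂)                       ≡⟨ cong (bit (g a) ℕ.+_) (count-++ g (suc a) L₁ L₂) ⟩
    bit (g a) + (count g (suc a) L₁ + count g (L₁ + suc a) L₂)  ≡⟨ cong (λ s → bit (g a) + (count g (suc a) L₁ + count g s L₂)) (ℕP.+-suc L₁ a) ⟩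
    bit (g a) + (count g (suc a) L₁ + count g (suc L₁ + a) L₂)  ≡⟨ sym (ℕP.+-assoc (bit (g a)) _ _) ⟩
    bit (g a) + count g (suc a) L₁ + count g (suc L₁ + a) L₂    ∎
    where open ≡-Reasoning

  count-suc : ∀ g L → count g 0 (suc L) ≡ count g 0 L + bit (g L)
  count-suc g L = begin
    count g 0 (suc L)                      ≡⟨ cong (count g 0) (ℕP.+-comm 1 L) ⟩
    count g 0 (L + 1)                      ≡⟨ count-++ g 0 L 1 ⟩
    count g 0 L + (bit (g (L + 0)) + 0)    ≡⟨ cong (λ x → count g 0 L + x) (trans (ℕP.+-identityʳ _) (cong (bit ∘ g) (ℕP.+-identityʳ L))) ⟩
    count g 0 L + bit (g L)                ∎
    where open ≡-Reasoning

  count-≤ : ∀ g a L → count g a L ≤ L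
  count-≤ g a zero    = z≤n
  count-≤ g a (suc L) = ℕP.+-mono-≤ (bit≤1 (g a)) (count-≤ g (suc a) L)
    where
    bit≤1 : ∀ b → bit b ≤ 1
    bit≤1 true  = s≤s z≤n
    bit≤1 false = z≤n

  count-+-count-not : ∀ g a L → count g a L + count (not ∘ g) a L ≡ L
  count-+-count-not g a zero    = refl
  count-+-count-not g a (suc L) =
    trans (interchange (bit (g a)) _ (bit (not (g a))) _) (cong₂ _+_ (bit-not (g a)) (count-+-count-not g (suc a) L))
    where
    bit-not : ∀ b → bit b + bit (not b) ≡ 1
    bit-not true  = refl
    bit-not false = refl

  count-split : ∀ (h g : ℕ → Bool) a L → count g a L ≡ count (λ x → h x ∧ g x) a L + count (λ x → not (h x) ∧ g x) a L
  count-split h g a zero    = refl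
  count-split h g a (suc L) =
    trans (cong₂ _+_ (bit-split (h a) (g a)) (count-split h g (suc a) L))
      (interchange (bit (h a ∧ g a)) (bit (not (h a) ∧ g a)) _ _)
    where
    bit-split : ∀ c b → bit b ≡ bit (c ∧ b) + bit (not c ∧ b)
    bit-split true  true  = refl
    bit-split true  false = refl
    bit-split false true  = refl
    bit-split false false = refl

  count-∨ : ∀ (g h : ℕ → Bool) a L → count (λ x → g x ∨ h x) a L ≤ count g a L + count h a L
  count-∨ g h a zero    = z≤n
  count-∨ g h a (suc L) = ℕP.≤-trans (ℕP.+-mono-≤ (bit-∨ (g a) (h a)) (count-∨ g h (suc a) L))
    (ℕP.≤-reflexive (interchange (bit (g a)) (bit (h a)) _ _))
    where
    bit-∨ : ∀ b c → bit (b ∨ c) ≤ bit b + bit c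
    bit-∨ true  c = s≤s z≤n
    bit-∨ false c = ℕP.≤-refl

count-false : ∀ g a L → (∀ i → i < L → g (i + a) ≡ false) → count g a L ≡ 0
count-false g a L all-false = trans (count-cong L {h = λ _ → false} {b = 0} all-false) (count-const-false L)
  where
  count-const-false : ∀ {a} L → count (λ _ → false) a L ≡ 0
  count-const-false zero    = refl
  count-const-false (suc L) = count-const-false L

count-≟ : ∀ j a L → count (λ i → does (j ℕ.≟ i)) a L ≤ 1
count-≟ j a zero    = z≤n
count-≟ j a (suc L) with j ℕ.≟ a
... | no j≢a rewrite Dec.dec-false (j ℕ.≟ a) j≢a = count-≟ j (suc a) L
... | yes refl rewrite Dec.dec-true (j ℕ.≟ j) refl = ℕP.≤-reflexive (cong suc (count-false _ (suc j) L λ i _ →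
                   Dec.dec-false (j ℕ.≟ i + suc j) (ℕP.<⇒≢ (ℕP.m≤n+m (suc j) i))))

module _ (g : ℕ → Bool) (Q : ℕ) (periodic : ∀ x y → g (x + y * Q) ≡ g x) where

  count-shift : ∀ a L → count g (a * Q) L ≡ count g 0 L
  count-shift a L = count-cong L λ i _ → trans (periodic i a) (cong g (sym (ℕP.+-identityʳ i)))

  count-periods : ∀ c → count g 0 (c * Q) ≡ c * count g 0 Q
  count-periods zero    = refl
  count-periods (suc c) = begin
    count g 0 (Q + c * Q)                ≡⟨ count-++ g 0 Q (c * Q) ⟩
    count g 0 Q + count g (Q + 0) (c * Q) ≡⟨ cong (λ a → count g 0 Q + count g a (c * Q)) (trans (ℕP.+-identityʳ Q) (sym (ℕP.*-identityˡ Q))) ⟩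
    count g 0 Q + count g (1 * Q) (c * Q) ≡⟨ cong (count g 0 Q ℕ.+_) (trans (count-shift 1 (c * Q)) (count-periods c)) ⟩
    count g 0 Q + c * count g 0 Q        ∎
    where open ≡-Reasoning

divisible : ℕ → ℕ → Bool
divisible q x = does (q ND.∣? x)

divisible-cong : ∀ q {x y} → (q ND.∣ x → q ND.∣ y) → (q ND.∣ y → q ND.∣ x) → divisible q x ≡ divisible q y
divisible-cong q {x} {y} x⇒y y⇒x with q ND.∣? x
... | yes q∣x = sym (Dec.dec-true (q ND.∣? y) (x⇒y q∣x))
... | no q∤x  = sym (Dec.dec-false (q ND.∣? y) (q∤x ∘ y⇒x))

count-multiples : ∀ q .{{_ : ℕ.NonZero q}} (g : ℕ → Bool) a L →
  count (λ x → divisible q x ∧ g x) (q * a) (q * L) ≡ count (g ∘ (q *_)) a L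
count-multiples q g a zero    = cong (count _ (q * a)) (ℕP.*-zeroʳ q)
count-multiples q@(suc q-1) g a (suc L) = begin
  count h (q * a) (q * suc L)                  ≡⟨ cong (count h (q * a)) (ℕP.*-suc q L) ⟩
  count h (q * a) (q + q * L)                  ≡⟨ count-++ h (q * a) q (q * L) ⟩
  count h (q * a) q + count h (q + q * a) (q * L) ≡⟨ cong₂ _+_ one-multiple-per-block (cong (λ b → count h b (q * L)) (sym (ℕP.*-suc q a))) ⟩
  bit (g (q * a)) + count h (q * suc a) (q * L) ≡⟨ cong (bit (g (q * a)) ℕ.+_) (count-multiples q g (suc a) L) ⟩
  bit (g (q * a)) + count (g ∘ (q *_)) (suc a) L ∎
  where
  open ≡-Reasoning
  h : ℕ → Bool
  h x = divisible q x ∧ g x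
  one-multiple-per-block : count h (q * a) q ≡ bit (g (q * a))
  one-multiple-per-block = begin
    bit (h (q * a)) + count h (suc (q * a)) q-1 ≡⟨ cong (λ b → bit (b ∧ g (q * a)) + count h (suc (q * a)) q-1) (Dec.dec-true (q ND.∣? q * a) (ND.m∣m*n a)) ⟩
    bit (g (q * a)) + count h (suc (q * a)) q-1 ≡⟨ cong (bit (g (q * a)) ℕ.+_) (count-false h (suc (q * a)) q-1 λ i i<q-1 →
                                                     cong (_∧ g (i + suc (q * a))) (Dec.dec-false (q ND.∣? (i + suc (q * a))) (not-multiple i i<q-1))) ⟩
    bit (g (q * a)) + 0                        ≡⟨ ℕP.+-identityʳ _ ⟩
    bit (g (q * a))                            ∎
    where
    not-multiple : ∀ i → i < q-1 → ¬ q ND.∣ i + suc (q * a)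
    not-multiple i i<q-1 q∣ = ℕP.<⇒≱ (s≤s i<q-1) (ND.∣⇒≤ (ND.∣m+n∣m⇒∣n q∣q*a+suc-i (ND.m∣m*n a)))
      where
      q∣q*a+suc-i : q ND.∣ q * a + suc i
      q∣q*a+suc-i = subst (q ND.∣_) (trans (ℕP.+-suc i (q * a)) (ℕP.+-comm (suc i) (q * a))) q∣

indicesWhere : (ℕ → Bool) → ℕ → ℕ → List ℕ
indicesWhere g a zero    = []
indicesWhere g a (suc L) with g a
... | true  = a ∷ indicesWhere g (suc a) L
... | false = indicesWhere g (suc a) L

length-indicesWhere : ∀ g a L → length (indicesWhere g a L) ≡ count g a L
length-indicesWhere g a zero    = refl
length-indicesWhere g a (suc L) with g a
... | true  = cong suc (length-indicesWhere g (suc a) L)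
... | false = length-indicesWhere g (suc a) L

∈-indicesWhere⁺ : ∀ g {a} L {m} → a ≤ m → m < L + a → g m ≡ true → m ∈ indicesWhere g a L
∈-indicesWhere⁺ g zero    a≤m m<a _ = ⊥-elim (ℕP.<⇒≱ m<a a≤m)
∈-indicesWhere⁺ g {a} (suc L) {m} a≤m m<L+a gm with ℕP.m≤n⇒m<n∨m≡n a≤m
... | inj₂ refl rewrite gm = here refl
... | inj₁ a<m with g a
...   | true  = there (∈-indicesWhere⁺ g L a<m (subst (m <_) (sym (ℕP.+-suc L a)) m<L+a) gm)
...   | false = ∈-indicesWhere⁺ g L a<m (subst (m <_) (sym (ℕP.+-suc L a)) m<L+a) gm

-- Rationals and Bishop reals

module _ where
  open ℚSolver.+-*-Solver

  p≤∣p∣ : ∀ p → p ℚ.≤ ℚ.∣ p ∣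
  p≤∣p∣ (mkℚ (+ n) d c)    = ℚP.≤-refl
  p≤∣p∣ (mkℚ ℤ.-[1+ n ] d c) = *≤* ℤ.-≤+

  /-≤ : ∀ a m b n .{{_ : ℕ.NonZero m}} .{{_ : ℕ.NonZero n}} → a * n ≤ b * m → (+ a) / m ℚ.≤ (+ b) / n
  /-≤ a (suc m) b (suc n) le = ℚP.toℚᵘ-cancel-≤
    (ℚᵘP.≤-respʳ-≃ (ℚᵘP.≃-sym (ℚP.toℚᵘ-fromℚᵘ (mkℚᵘ (+ b) n)))
     (ℚᵘP.≤-respˡ-≃ (ℚᵘP.≃-sym (ℚP.toℚᵘ-fromℚᵘ (mkℚᵘ (+ a) m)))
       (ℚᵘ.*≤* (subst₂ ℤ._≤_ (ℤP.pos-* a (suc n)) (ℤP.pos-* b (suc m)) (ℤ.+≤+ le)))))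

  /-< : ∀ a m b n .{{_ : ℕ.NonZero m}} .{{_ : ℕ.NonZero n}} → a * n < b * m → (+ a) / m ℚ.< (+ b) / n
  /-< a (suc m) b (suc n) lt = ℚP.toℚᵘ-cancel-<
    (ℚᵘP.<-respʳ-≃ (ℚᵘP.≃-sym (ℚP.toℚᵘ-fromℚᵘ (mkℚᵘ (+ b) n)))
     (ℚᵘP.<-respˡ-≃ (ℚᵘP.≃-sym (ℚP.toℚᵘ-fromℚᵘ (mkℚᵘ (+ a) m)))
       (ℚᵘ.*<* (subst₂ ℤ._<_ (ℤP.pos-* a (suc n)) (ℤP.pos-* b (suc m)) (ℤ.+<+ lt)))))

  /-≡ : ∀ a m b n .{{_ : ℕ.NonZero m}} .{{_ : ℕ.NonZero n}} → a * n ≡ b * m → (+ a) / m ≡ (+ b) / n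
  /-≡ a m b n eq = ℚP.≤-antisym (/-≤ a m b n (ℕP.≤-reflexive eq)) (/-≤ b n a m (ℕP.≤-reflexive (sym eq)))

  /-+ : ∀ a m b n .{{_ : ℕ.NonZero m}} .{{_ : ℕ.NonZero n}} →
        (+ a) / m ℚ.+ (+ b) / n ≡ ((+ (a * n + b * m)) / (m * n)) {{ℕP.m*n≢0 m n}}
  /-+ a (suc m) b (suc n) = ℚP.toℚᵘ-injective (ℚᵘP.≃-trans (ℚP.toℚᵘ-homo-+ ((+ a) / suc m) ((+ b) / suc n))
    (ℚᵘP.≃-trans (ℚᵘP.+-cong (ℚP.toℚᵘ-fromℚᵘ (mkℚᵘ (+ a) m)) (ℚP.toℚᵘ-fromℚᵘ (mkℚᵘ (+ b) n)))
    (ℚᵘP.≃-trans (ℚᵘP.≃-reflexive (cong (λ z → mkℚᵘ z _) (sym (trans (ℤP.pos-+ (a * suc n) (b * suc m)) (cong₂ ℤ._+_ (ℤP.pos-* a (suc n)) (ℤP.pos-* b (suc m)))))))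
     (ℚᵘP.≃-sym (ℚP.toℚᵘ-fromℚᵘ (mkℚᵘ (+ (a * suc n + b * suc m)) _))))))

  /-* : ∀ a m b n .{{_ : ℕ.NonZero m}} .{{_ : ℕ.NonZero n}} →
        ((+ a) / m) ℚ.* ((+ b) / n) ≡ ((+ (a * b)) / (m * n)) {{ℕP.m*n≢0 m n}}
  /-* a (suc m) b (suc n) = ℚP.toℚᵘ-injective (ℚᵘP.≃-trans (ℚP.toℚᵘ-homo-* ((+ a) / suc m) ((+ b) / suc n))
    (ℚᵘP.≃-trans (ℚᵘP.*-cong (ℚP.toℚᵘ-fromℚᵘ (mkℚᵘ (+ a) m)) (ℚP.toℚᵘ-fromℚᵘ (mkℚᵘ (+ b) n)))
    (ℚᵘP.≃-trans (ℚᵘP.≃-reflexive (cong (λ z → mkℚᵘ z _) (sym (ℤP.pos-* a b))))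
     (ℚᵘP.≃-sym (ℚP.toℚᵘ-fromℚᵘ (mkℚᵘ (+ (a * b)) _))))))

  1-1/[1+m] : ∀ m → 1ℚ ℚ.- (+ 1) / suc m ≡ (+ m) / suc m
  1-1/[1+m] m = begin
    1ℚ ℚ.- y                ≡⟨ cong (ℚ._- y) (sym x+y≡1) ⟩
    (x ℚ.+ y) ℚ.- y         ≡⟨ solve 2 (λ x y → (x :+ y) :- y := x) refl x y ⟩
    x                       ∎
    where
    open ≡-Reasoning
    x = (+ m) / suc m
    y = (+ 1) / suc m
    x+y≡1 : x ℚ.+ y ≡ 1ℚ
    x+y≡1 = trans (/-+ m (suc m) 1 (suc m)) (/-≡ (m * suc m + 1 * suc m) (suc m * suc m) 1 1 (numerator m))
      where
      numerator : ∀ m → (m * suc m + 1 * suc m) * 1 ≡ 1 * (suc m * suc m)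
      numerator = ℕSolver.solve-∀

  inv+inv<ε : ∀ {ε} → 0ℚ ℚ.< ε → ∃[ j ] (inv j ℚ.+ inv j ℚ.< ε)
  inv+inv<ε {mkℚ (+ 0) d _}     (ℚ.*<* (ℤ.+<+ ()))
  inv+inv<ε {mkℚ ℤ.-[1+ n ] d _} (ℚ.*<* ())
  inv+inv<ε {ε@(mkℚ (+ suc n) d _)} _ = j , (begin-strict
    inv j ℚ.+ inv j                                 ≡⟨ /-+ 1 (suc j) 1 (suc j) ⟩
    (+ (1 * suc j + 1 * suc j)) / (suc j * suc j)   <⟨ /-< (1 * suc j + 1 * suc j) (suc j * suc j) (suc n) (suc d) two*D<[1+n]*[1+j]² ⟩
    (+ suc n) / suc d                               ≡⟨ ℚP.fromℚᵘ-toℚᵘ ε ⟩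
    ε                                               ∎)
    where
    open ℚP.≤-Reasoning
    j = 2 * suc d
    two*D<[1+n]*[1+j]² : (1 * suc j + 1 * suc j) * suc d < suc n * (suc j * suc j)
    two*D<[1+n]*[1+j]² = ℕP.≤-trans (ℕP.≤-reflexive (cong suc (rearrange (suc j) (suc d))))
      (ℕP.≤-trans (ℕP.*-monoʳ-< (suc j) {j} {suc j} ℕP.≤-refl) (ℕP.m≤n*m (suc j * suc j) (suc n)))
      where
      rearrange : ∀ s D → (1 * s + 1 * s) * D ≡ s * (2 * D)
      rearrange = ℕSolver.solve-∀

  p<q⇒0<q-p : ∀ {p q} → p ℚ.< q → 0ℚ ℚ.< q ℚ.- p
  p<q⇒0<q-p {p} {q} p<q = begin-strict
    0ℚ        ≡⟨ sym (ℚP.+-inverseʳ p) ⟩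
    p ℚ.- p   <⟨ ℚP.+-monoˡ-< (ℚ.- p) p<q ⟩
    q ℚ.- p   ∎
    where open ℚP.≤-Reasoning

  ≤-from-inv : ∀ x y → (∀ j → x ℚ.≤ y ℚ.+ (inv j ℚ.+ inv j)) → x ℚ.≤ y
  ≤-from-inv x y x≤y+ε with x ℚ.≤? y
  ... | yes x≤y = x≤y
  ... | no x≰y with inv+inv<ε (p<q⇒0<q-p (ℚP.≰⇒> x≰y))
  ...   | j , ε<x-y = ⊥-elim (ℚP.<-irrefl refl (ℚP.≤-<-trans (x≤y+ε j) (begin-strict
    y ℚ.+ (inv j ℚ.+ inv j)   <⟨ ℚP.+-monoʳ-< y ε<x-y ⟩
    y ℚ.+ (x ℚ.- y)           ≡⟨ solve 2 (λ x y → y :+ (x :- y) := x) refl x y ⟩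
    x                         ∎)))
    where open ℚP.≤-Reasoning

  private
    <-∸⇒+< : ∀ {a x c} → a ℚ.< x ℚ.- c → c ℚ.+ a ℚ.< x
    <-∸⇒+< {a} {x} {c} a<x-c = begin-strict
      c ℚ.+ a           <⟨ ℚP.+-monoʳ-< c a<x-c ⟩
      c ℚ.+ (x ℚ.- c)   ≡⟨ solve 2 (λ x c → c :+ (x :- c) := x) refl x c ⟩
      x                 ∎
      where open ℚP.≤-Reasoning

    0≤inv : ∀ j → 0ℚ ℚ.≤ inv j
    0≤inv j = /-≤ 0 1 1 (suc j) z≤n

  <ℝ⇒¬approximable-from-below : ∀ {c r} → c <ℝ r → ¬ (∀ j → ∃[ q ] (DistLe q r (inv j) × q ℚ.≤ c ℚ.+ inv j))
  <ℝ⇒¬approximable-from-below {c} {r} (n , inv-n<x-c) approximable =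
    ℚP.<-irrefl refl (ℚP.<-≤-trans (<-∸⇒+< inv-n<x-c) (≤-from-inv x (c ℚ.+ inv n) x≤c+inv-n+ε))
    where
    x = seq r n
    x≤c+inv-n+ε : ∀ j → x ℚ.≤ (c ℚ.+ inv n) ℚ.+ (inv j ℚ.+ inv j)
    x≤c+inv-n+ε j with approximable j
    ... | q , q≈r , q≤c+inv-j = begin
      x                                     ≡⟨ solve 2 (λ x q → x := (x :- q) :+ q) refl x q ⟩
      (x ℚ.- q) ℚ.+ q                       ≤⟨ ℚP.+-mono-≤ x-q≤inv-j+inv-n q≤c+inv-j ⟩
      (inv j ℚ.+ inv n) ℚ.+ (c ℚ.+ inv j)   ≡⟨ solve 3 (λ a b c → (a :+ b) :+ (c :+ a) := (c :+ b) :+ (a :+ a)) refl (inv j) (inv n) c ⟩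
      (c ℚ.+ inv n) ℚ.+ (inv j ℚ.+ inv j)   ∎
      where
      open ℚP.≤-Reasoning
      x-q≤inv-j+inv-n : x ℚ.- q ℚ.≤ inv j ℚ.+ inv n
      x-q≤inv-j+inv-n = begin
        x ℚ.- q               ≤⟨ p≤∣p∣ (x ℚ.- q) ⟩
        ℚ.∣ x ℚ.- q ∣         ≡⟨ sym (trans (cong ℚ.∣_∣ (solve 2 (λ x q → q :- x := :- (x :- q)) refl x q)) (ℚP.∣-p∣≡∣p∣ (x ℚ.- q))) ⟩
        ℚ.∣ q ℚ.- x ∣         ≤⟨ q≈r n ⟩
        inv j ℚ.+ inv n       ∎

  ℝ<⇒¬approximable : ∀ {r c} → r ℝ< c → ¬ (∀ j → DistLe c r (inv j))
  ℝ<⇒¬approximable {r} {c} (n , inv-n<c-x) c≈r =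
    ℚP.<-irrefl refl (ℚP.<-≤-trans (<-∸⇒+< inv-n<c-x) (≤-from-inv c (x ℚ.+ inv n) c≤x+inv-n+ε))
    where
    x = seq r n
    c≤x+inv-n+ε : ∀ j → c ℚ.≤ (x ℚ.+ inv n) ℚ.+ (inv j ℚ.+ inv j)
    c≤x+inv-n+ε j = begin
      c                                   ≡⟨ solve 2 (λ c x → c := (c :- x) :+ x) refl c x ⟩
      (c ℚ.- x) ℚ.+ x                     ≤⟨ ℚP.+-monoˡ-≤ x (ℚP.≤-trans (p≤∣p∣ (c ℚ.- x)) (c≈r j n)) ⟩
      (inv j ℚ.+ inv n) ℚ.+ x             ≤⟨ ℚP.+-monoˡ-≤ x (ℚP.+-monoˡ-≤ (inv n) (ℚP.≤-trans (ℚP.≤-reflexive (sym (ℚP.+-identityʳ (inv j)))) (ℚP.+-monoʳ-≤ (inv j) (0≤inv j)))) ⟩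
      ((inv j ℚ.+ inv j) ℚ.+ inv n) ℚ.+ x ≡⟨ solve 3 (λ a b x → (a :+ b) :+ x := (x :+ b) :+ a) refl (inv j ℚ.+ inv j) (inv n) x ⟩
      (x ℚ.+ inv n) ℚ.+ (inv j ℚ.+ inv j) ∎
      where open ℚP.≤-Reasoning

  window-cross-≤ : ∀ {N Φ c Q S j} .{{_ : ℕ.NonZero Q}} → N + c * Φ ≡ S + c * Q → S * suc j ≤ c →
    (N * Q + Φ * (c * Q)) * (1 * suc j) ≤ (1 * suc j + 1 * 1) * (c * Q * Q)
  window-cross-≤ {N} {Φ} {c} {Q} {S} {j} N+cΦ≡S+L S*[1+j]≤c = begin
    (N * Q + Φ * L) * (1 * suc j)       ≡⟨ collect N Φ c Q (suc j) ⟩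
    (N + c * Φ) * Q * suc j             ≡⟨ cong (λ n → n * Q * suc j) N+cΦ≡S+L ⟩
    (S + L) * Q * suc j                 ≡⟨ expand S L Q (suc j) ⟩
    S * suc j * Q + L * Q * suc j       ≤⟨ ℕP.+-monoˡ-≤ (L * Q * suc j) (ℕP.*-monoˡ-≤ Q (ℕP.≤-trans S*[1+j]≤c (ℕP.m≤m*n c Q))) ⟩
    L * Q + L * Q * suc j               ≡⟨ factor (L * Q) (suc j) ⟩
    (1 * suc j + 1 * 1) * (L * Q)       ∎
    where
    open ℕP.≤-Reasoning
    L = c * Q
    collect : ∀ n φ c q s → (n * q + φ * (c * q)) * (1 * s) ≡ (n + c * φ) * q * s
    collect = ℕSolver.solve-∀
    expand : ∀ a l q s → (a + l) * q * s ≡ a * s * q + l * q * s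
    expand = ℕSolver.solve-∀
    factor : ∀ x s → x + x * s ≡ (1 * s + 1 * 1) * x
    factor = ℕSolver.solve-∀

  -- Used with a ≤ S + (c Q - c Φ) because the A-points up to X are among the S orbit points
  -- before the window and its non-survivors, and with c Q ≤ b + 1 because the window lies below X.
  window-ratio-bound : ∀ {a b S c Q Φ} j .{{_ : ℕ.NonZero c}} .{{_ : ℕ.NonZero Q}} → Φ ≤ Q → S * suc j ≤ c →
    a ≤ S + (c * Q ∸ c * Φ) → c * Q ≤ suc b → (+ a) / suc b ℚ.≤ (1ℚ ℚ.- (+ Φ) / Q) ℚ.+ inv j
  window-ratio-bound {a} {b} {S} {c} {Q} {Φ} j Φ≤Q S*[1+j]≤c a≤N L≤1+b = begin
    q                                   ≡⟨ solve 2 (λ q x → q := (q :+ x) :- x) refl q (+ Φ / Q) ⟩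
    (q ℚ.+ (+ Φ) / Q) ℚ.- (+ Φ) / Q      ≤⟨ ℚP.+-monoˡ-≤ (ℚ.- ((+ Φ) / Q)) (ℚP.+-monoˡ-≤ ((+ Φ) / Q) q≤N/L) ⟩
    ((+ N) / L ℚ.+ (+ Φ) / Q) ℚ.- (+ Φ) / Q ≤⟨ ℚP.+-monoˡ-≤ (ℚ.- ((+ Φ) / Q)) N/L+Φ/Q≤1+inv-j ⟩
    (1ℚ ℚ.+ inv j) ℚ.- (+ Φ) / Q         ≡⟨ solve 2 (λ e x → (con 1ℚ :+ e) :- x := (con 1ℚ :- x) :+ e) refl (inv j) (+ Φ / Q) ⟩
    (1ℚ ℚ.- (+ Φ) / Q) ℚ.+ inv j         ∎
    where
    open ℚP.≤-Reasoning
    L = c * Q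
    N = S + (L ∸ c * Φ)
    q = (+ a) / suc b
    instance
      L≢0 : ℕ.NonZero L
      L≢0 = ℕP.m*n≢0 c Q
    q≤N/L : q ℚ.≤ (+ N) / L
    q≤N/L = /-≤ a (suc b) N L (ℕP.*-mono-≤ a≤N L≤1+b)
    N+cΦ≡S+L : N + c * Φ ≡ S + L
    N+cΦ≡S+L = trans (ℕP.+-assoc S _ _) (cong (S ℕ.+_) (ℕP.m∸n+n≡m (ℕP.*-monoʳ-≤ c Φ≤Q)))
    N/L+Φ/Q≤1+inv-j : (+ N) / L ℚ.+ (+ Φ) / Q ℚ.≤ 1ℚ ℚ.+ inv j
    N/L+Φ/Q≤1+inv-j = begin
      (+ N) / L ℚ.+ (+ Φ) / Q                         ≡⟨ /-+ N L Φ Q ⟩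
      ((+ (N * Q + Φ * L)) / (L * Q)) {{ℕP.m*n≢0 L Q}} ≤⟨ /-≤ (N * Q + Φ * L) (L * Q) (1 * suc j + 1 * 1) (1 * suc j) {{ℕP.m*n≢0 L Q}} (window-cross-≤ N+cΦ≡S+L S*[1+j]≤c) ⟩
      (+ (1 * suc j + 1 * 1)) / (1 * suc j)            ≡⟨ sym (/-+ 1 1 1 (suc j)) ⟩
      1ℚ ℚ.+ inv j                                    ∎

-- Sieving by the primes of an enumeration

scaleIf : Bool → ℕ → ℕ → ℕ
scaleIf true  a n = a * n
scaleIf false a n = n

*∸1-cross-≤ : ∀ {a b} → a ≤ b → b * (a ∸ 1) ≤ (b ∸ 1) * a
*∸1-cross-≤ {a} {b} a≤b = begin
  b * (a ∸ 1)   ≡⟨ ℕP.*-distribˡ-∸ b a 1 ⟩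
  b * a ∸ b * 1 ≤⟨ ℕP.∸-monoʳ-≤ (b * a) (ℕP.≤-trans (ℕP.≤-reflexive (ℕP.*-identityʳ a)) (ℕP.≤-trans a≤b (ℕP.≤-reflexive (sym (ℕP.*-identityʳ b))))) ⟩
  b * a ∸ a * 1 ≡⟨ cong (_∸ a * 1) (ℕP.*-comm b a) ⟩
  a * b ∸ a * 1 ≡⟨ sym (ℕP.*-distribˡ-∸ a b 1) ⟩
  a * (b ∸ 1)   ≡⟨ ℕP.*-comm a (b ∸ 1) ⟩
  (b ∸ 1) * a   ∎
  where open ℕP.≤-Reasoning

module Sieve (p : ℕ → ℕ) (p-prime : ∀ i → Prime (p i)) (p-increasing : ∀ i → p i < p (suc i)) where

  2≤p : ∀ i → 2 ≤ p i
  2≤p i = ℕ.nonTrivial⇒n>1 (p i) {{prime⇒nonTrivial (p-prime i)}}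

  p-mono-< : ∀ {i j} → i < j → p i < p j
  p-mono-< {i} {suc j} (s≤s i≤j) with ℕP.m≤n⇒m<n∨m≡n i≤j
  ... | inj₁ i<j  = ℕP.<-trans (p-mono-< i<j) (p-increasing j)
  ... | inj₂ refl = p-increasing i

  p-mono-≤ : ∀ {i j} → i ≤ j → p i ≤ p j
  p-mono-≤ i≤j with ℕP.m≤n⇒m<n∨m≡n i≤j
  ... | inj₁ i<j  = ℕP.<⇒≤ (p-mono-< i<j)
  ... | inj₂ refl = ℕP.≤-refl

  primeProduct : ℕ → ℕ
  primeProduct zero    = 1
  primeProduct (suc k) = p k * primeProduct k

  totientProduct : ℕ → ℕ
  totientProduct zero    = 1
  totientProduct (suc k) = (p k ∸ 1) * totientProduct k

  primeProduct≢0 : ∀ k → ℕ.NonZero (primeProduct k)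
  primeProduct≢0 zero    = _
  primeProduct≢0 (suc k) = ℕP.m*n≢0 (p k) (primeProduct k) {{prime⇒nonZero (p-prime k)}} {{primeProduct≢0 k}}

  totient/prime-antitone : ∀ {c k} → c ≤ k → primeProduct c * totientProduct k ≤ totientProduct c * primeProduct k
  totient/prime-antitone {c} {k} c≤k with ℕP.m≤n⇒m<n∨m≡n c≤k
  ... | inj₂ refl = ℕP.≤-reflexive (ℕP.*-comm (primeProduct c) (totientProduct c))
  ... | inj₁ (s≤s {n = k'} c≤k') = begin
    P c * ((p k' ∸ 1) * Ψ k')   ≡⟨ swap (P c) (p k' ∸ 1) (Ψ k') ⟩
    (P c * Ψ k') * (p k' ∸ 1)   ≤⟨ ℕP.*-mono-≤ (totient/prime-antitone c≤k') (ℕP.m∸n≤m (p k') 1) ⟩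
    (Ψ c * P k') * p k'         ≡⟨ sym (swap (Ψ c) (p k') (P k')) ⟩
    Ψ c * (p k' * P k')         ∎
    where
    open ℕP.≤-Reasoning
    P = primeProduct
    Ψ = totientProduct
    swap : ∀ a b c → a * (b * c) ≡ (a * c) * b
    swap = ℕSolver.solve-∀

  module _ (sel : ℕ → Bool) where

    modulus : ℕ → ℕ
    modulus zero    = 1
    modulus (suc B) = scaleIf (sel B) (p B) (modulus B)

    survivorCount : ℕ → ℕ
    survivorCount zero    = 1
    survivorCount (suc B) = scaleIf (sel B) (p B ∸ 1) (survivorCount B)

    survives : ℕ → ℕ → Bool
    survives zero    x = true
    survives (suc B) x = not (sel B ∧ divisible (p B) x) ∧ survives B x

    selected : ℕ → ℕ
    selected B = count sel 0 B

    survives-periodic : ∀ B x y → survives B (x + y * modulus B) ≡ survives B x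
    survives-periodic zero    x y = refl
    survives-periodic (suc B) x y with sel B
    ... | false = survives-periodic B x y
    ... | true  = cong₂ (λ d s → not d ∧ s)
                    (divisible-cong (p B) {x + y * (p B * modulus B)} {x}
                      (λ pB∣ → ND.∣m+n∣m⇒∣n (subst (p B ND.∣_) (ℕP.+-comm x _) pB∣) pB∣period) (λ pB∣ → ND.∣m∣n⇒∣m+n pB∣ pB∣period))
                    (trans (cong (λ z → survives B (x + z)) (sym (ℕP.*-assoc y (p B) (modulus B)))) (survives-periodic B x (y * p B)))
      where
      pB∣period : p B ND.∣ y * (p B * modulus B)
      pB∣period = ND.∣n⇒∣m*n y (ND.m∣m*n (modulus B))

    survives-multiple : ∀ B {j} y → B ≤ j → survives B (p j * y) ≡ survives B y
    survives-multiple zero    y B≤j = refl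
    survives-multiple (suc B) {j} y B<j with sel B
    ... | false = survives-multiple B y (ℕP.<⇒≤ B<j)
    ... | true  = cong₂ (λ d s → not d ∧ s) (divisible-cong (p B) {p j * y} {y} pB∣pj*y⇒pB∣y (ND.∣n⇒∣m*n (p j))) (survives-multiple B y (ℕP.<⇒≤ B<j))
      where
      pB∣pj*y⇒pB∣y : p B ND.∣ p j * y → p B ND.∣ y
      pB∣pj*y⇒pB∣y pB∣ with euclidsLemma (p j) y (p-prime B) pB∣
      ... | inj₂ pB∣y = pB∣y
      ... | inj₁ pB∣pj with prime⇒irreducible (p-prime j) pB∣pj
      ...   | inj₁ pB≡1  = ⊥-elim (ℕP.<⇒≱ (2≤p B) (ℕP.≤-reflexive pB≡1))
      ...   | inj₂ pB≡pj = ⊥-elim (ℕP.<⇒≢ (p-mono-< B<j) pB≡pj)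

    survives-divisible : ∀ B {i x} → i < B → sel i ≡ true → p i ND.∣ x → survives B x ≡ false
    survives-divisible (suc B) {i} {x} (s≤s i≤B) sel-i pi∣x with ℕP.m≤n⇒m<n∨m≡n i≤B
    ... | inj₁ i<B  = trans (cong (not (sel B ∧ divisible (p B) x) ∧_) (survives-divisible B i<B sel-i pi∣x))
                        (BoolP.∧-zeroʳ _)
    ... | inj₂ refl rewrite sel-i | Dec.dec-true (p i ND.∣? x) pi∣x = refl

    count-survives : ∀ B → count (survives B) 0 (modulus B) ≡ survivorCount B
    count-survives zero    = refl
    count-survives (suc B) = step (sel B)
      where
      Q = modulus B
      Φ = survivorCount B
      s = survives B
      step : ∀ b → count (λ x → not (b ∧ divisible (p B) x) ∧ s x) 0 (scaleIf b (p B) Q) ≡ scaleIf b (p B ∸ 1) Φ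
      step false = count-survives B
      step true  = begin
        count (λ x → not (divisible (p B) x) ∧ s x) 0 (p B * Q)    ≡⟨ sym (ℕP.m+n∸m≡n (count (λ x → divisible (p B) x ∧ s x) 0 (p B * Q)) _) ⟩
        count (λ x → divisible (p B) x ∧ s x) 0 (p B * Q) + count (λ x → not (divisible (p B) x) ∧ s x) 0 (p B * Q)
          ∸ count (λ x → divisible (p B) x ∧ s x) 0 (p B * Q)     ≡⟨ cong₂ _∸_ (sym (count-split (divisible (p B)) s 0 (p B * Q))) multiples ⟩
        count s 0 (p B * Q) ∸ Φ                                    ≡⟨ cong (_∸ Φ) (trans (count-periods s Q (survives-periodic B) (p B)) (cong (p B *_) (count-survives B))) ⟩
        p B * Φ ∸ Φ                                                 ≡⟨ cong (p B * Φ ∸_) (sym (ℕP.*-identityˡ Φ)) ⟩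
        p B * Φ ∸ 1 * Φ                                             ≡⟨ sym (ℕP.*-distribʳ-∸ Φ (p B) 1) ⟩
        (p B ∸ 1) * Φ                                               ∎
        where
        open ≡-Reasoning
        instance
          pB≢0 : ℕ.NonZero (p B)
          pB≢0 = prime⇒nonZero (p-prime B)
        multiples : count (λ x → divisible (p B) x ∧ s x) 0 (p B * Q) ≡ Φ
        multiples = begin
          count (λ x → divisible (p B) x ∧ s x) 0 (p B * Q)       ≡⟨ cong (λ a → count (λ x → divisible (p B) x ∧ s x) a (p B * Q)) (sym (ℕP.*-zeroʳ (p B))) ⟩
          count (λ x → divisible (p B) x ∧ s x) (p B * 0) (p B * Q) ≡⟨ count-multiples (p B) s 0 Q ⟩
          count (s ∘ (p B *_)) 0 Q                                ≡⟨ count-cong Q (λ i _ → survives-multiple B (i + 0) ℕP.≤-refl) ⟩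
          count s 0 Q                                             ≡⟨ count-survives B ⟩
          Φ                                                       ∎

    -- survivorCount B / modulus B is the product of 1 - 1/p_i over the selected i < B; as the
    -- l-th selected index is at least l, it dominates the product over the first (selected B) primes.
    survivor-density : ∀ B → modulus B * totientProduct (selected B) ≤ survivorCount B * primeProduct (selected B)
    survivor-density zero    = ℕP.≤-refl
    survivor-density (suc B) =
      subst (λ c → modulus (suc B) * totientProduct c ≤ survivorCount (suc B) * primeProduct c)
        (sym (count-suc sel B)) (step (sel B))
      where
      Q = modulus B
      Φ = survivorCount B
      c = selected B
      rearrange : ∀ a b c d → (a * b) * (c * d) ≡ (a * c) * (b * d)
      rearrange = ℕSolver.solve-∀
      step : ∀ b → scaleIf b (p B) Q * totientProduct (c + bit b) ≤ scaleIf b (p B ∸ 1) Φ * primeProduct (c + bit b)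
      step false rewrite ℕP.+-identityʳ c = survivor-density B
      step true  rewrite ℕP.+-comm c 1 = begin
        (p B * Q) * ((p c ∸ 1) * totientProduct c)   ≡⟨ rearrange (p B) Q (p c ∸ 1) (totientProduct c) ⟩
        (p B * (p c ∸ 1)) * (Q * totientProduct c)   ≤⟨ ℕP.*-mono-≤ (*∸1-cross-≤ (p-mono-≤ (count-≤ sel 0 B))) (survivor-density B) ⟩
        ((p B ∸ 1) * p c) * (Φ * primeProduct c)     ≡⟨ rearrange (p B ∸ 1) (p c) Φ (primeProduct c) ⟩
        ((p B ∸ 1) * Φ) * (p c * primeProduct c)     ∎
        where open ℕP.≤-Reasoning

    survivor-density-≥ : ∀ B {k} → selected B ≤ k → modulus B * totientProduct k ≤ survivorCount B * primeProduct k
    survivor-density-≥ B {k} c≤k = ℕP.*-cancelʳ-≤ _ _ (primeProduct c) {{primeProduct≢0 c}} (begin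
      (Q * Ψ k) * P c   ≡⟨ rearrange Q (Ψ k) (P c) ⟩
      Q * (P c * Ψ k)   ≤⟨ ℕP.*-monoʳ-≤ Q (totient/prime-antitone c≤k) ⟩
      Q * (Ψ c * P k)   ≡⟨ sym (ℕP.*-assoc Q (Ψ c) (P k)) ⟩
      (Q * Ψ c) * P k   ≤⟨ ℕP.*-monoˡ-≤ (P k) (survivor-density B) ⟩
      (Φ * P c) * P k   ≡⟨ rearrange' Φ (P c) (P k) ⟩
      (Φ * P k) * P c   ∎)
      where
      open ℕP.≤-Reasoning
      Q = modulus B
      Φ = survivorCount B
      c = selected B
      P = primeProduct
      Ψ = totientProduct
      rearrange : ∀ a b c → (a * b) * c ≡ a * (c * b)
      rearrange = ℕSolver.solve-∀
      rearrange' : ∀ a b c → (a * b) * c ≡ (a * c) * b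
      rearrange' = ℕSolver.solve-∀

    modulus≢0 : ∀ B → ℕ.NonZero (modulus B)
    modulus≢0 zero    = _
    modulus≢0 (suc B) with sel B
    ... | false = modulus≢0 B
    ... | true  = ℕP.m*n≢0 (p B) (modulus B) {{prime⇒nonZero (p-prime B)}} {{modulus≢0 B}}


  prodPrimes-suc : ∀ k {m} → p k ≡ suc m → prodPrimes p (suc k) ≡ prodPrimes p k ℚ.* (1ℚ ℚ.- (+ 1) / suc m)
  prodPrimes-suc k pk≡1+m with p k | pk≡1+m
  ... | .(suc _) | refl = refl

  prodPrimes≡totient/prime : ∀ k → prodPrimes p k ≡ ((+ totientProduct k) / primeProduct k) {{primeProduct≢0 k}}
  prodPrimes≡totient/prime zero    = refl
  prodPrimes≡totient/prime (suc k) = begin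
    prodPrimes p (suc k)                       ≡⟨ prodPrimes-suc k pk≡1+m ⟩
    prodPrimes p k ℚ.* (1ℚ ℚ.- (+ 1) / suc m)   ≡⟨ cong₂ ℚ._*_ (prodPrimes≡totient/prime k) (1-1/[1+m] m) ⟩
    ((+ Ψ k) / P k) ℚ.* ((+ m) / suc m)         ≡⟨ /-* (Ψ k) (P k) m (suc m) ⟩
    (+ (Ψ k * m)) / (P k * suc m)              ≡⟨ /-≡ (Ψ k * m) (P k * suc m) (m * Ψ k) (p k * P k) cross ⟩
    (+ (m * Ψ k)) / (p k * P k)                ∎
    where
    open ≡-Reasoning
    P = primeProduct
    Ψ = totientProduct
    instance
      Pk≢0 : ℕ.NonZero (P k)
      Pk≢0 = primeProduct≢0 k
      P[1+k]≢0 : ℕ.NonZero (P (suc k))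
      P[1+k]≢0 = primeProduct≢0 (suc k)
      P*[1+m]≢0 : ℕ.NonZero (P k * suc (p k ∸ 1))
      P*[1+m]≢0 = ℕP.m*n≢0 (P k) (suc (p k ∸ 1))
    m = p k ∸ 1
    pk≡1+m : p k ≡ suc m
    pk≡1+m = sym (ℕP.suc-pred (p k) {{prime⇒nonZero (p-prime k)}})
    cross : Ψ k * m * (p k * P k) ≡ m * Ψ k * (P k * suc m)
    cross = begin
      Ψ k * m * (p k * P k)     ≡⟨ cong (λ a → Ψ k * m * (a * P k)) pk≡1+m ⟩
      Ψ k * m * (suc m * P k)   ≡⟨ rearrange (Ψ k) m (suc m) (P k) ⟩
      m * Ψ k * (P k * suc m)   ∎
      where
      rearrange : ∀ a b c d → a * b * (c * d) ≡ b * a * (d * c)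
      rearrange = ℕSolver.solve-∀

selectedBy : ∀ {k} → (Fin k → ℕ) → ℕ → Bool
selectedBy {zero}  φ i = false
selectedBy {suc k} φ i = does (φ Fin.zero ℕ.≟ i) ∨ selectedBy (φ ∘ Fin.suc) i

selectedBy-image : ∀ {k} (φ : Fin k → ℕ) s → selectedBy φ (φ s) ≡ true
selectedBy-image {suc k} φ Fin.zero    rewrite Dec.dec-true (φ Fin.zero ℕ.≟ φ Fin.zero) refl = refl
selectedBy-image {suc k} φ (Fin.suc s) = trans (cong (does (φ Fin.zero ℕ.≟ φ (Fin.suc s)) ∨_) (selectedBy-image (φ ∘ Fin.suc) s))
  (BoolP.∨-zeroʳ _)

count-selectedBy : ∀ {k} (φ : Fin k → ℕ) a L → count (selectedBy φ) a L ≤ k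
count-selectedBy {zero}  φ a L = ℕP.≤-reflexive (count-false _ a L λ _ _ → refl)
count-selectedBy {suc k} φ a L = ℕP.≤-trans (count-∨ (λ i → does (φ Fin.zero ℕ.≟ i)) (selectedBy (φ ∘ Fin.suc)) a L)
  (ℕP.+-mono-≤ (count-≟ (φ Fin.zero) a L) (count-selectedBy (φ ∘ Fin.suc) a L))

image<sum : ∀ {k} (φ : Fin k → ℕ) s → φ s < sumFinℕ k (suc ∘ φ)
image<sum φ Fin.zero    = ℕP.m≤m+n (suc (φ Fin.zero)) _
image<sum φ (Fin.suc s) = ℕP.≤-trans (image<sum (φ ∘ Fin.suc) s) (ℕP.m≤n+m _ (suc (φ Fin.zero)))

-- Densities along an orbit

module _ {S : ℤ → Set} {m : ℕ} (card : HasCard S m) where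
  private
    elements : List ℤ
    elements = proj₁ card
    elements-unique : Unique elements
    elements-unique = proj₁ (proj₂ card)
    ∈⇔S : ∀ x → (x ∈ elements) ⇔ S x
    ∈⇔S = proj₁ (proj₂ (proj₂ card))
    length≡m : length elements ≡ m
    length≡m = proj₂ (proj₂ (proj₂ card))

  HasCard⇒≤length : (l : List ℤ) → (∀ x → S x → x ∈ l) → m ≤ length l
  HasCard⇒≤length l S⊆l = subst (_≤ length l) length≡m
    (unique⊆⇒length≤ elements-unique λ {x} x∈ → S⊆l x (Equivalence.to (∈⇔S x) x∈))

  length≤HasCard : {l : List ℤ} → Unique l → (∀ x → x ∈ l → S x) → length l ≤ m
  length≤HasCard uniq l⊆S = subst (_ ≤_) length≡m
    (unique⊆⇒length≤ uniq λ {x} x∈ → Equivalence.from (∈⇔S x) (l⊆S x x∈))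

  HasCard-covers : ∀ x → S x → x ∈ proj₁ card
  HasCard-covers x = Equivalence.from (∈⇔S x)

HasCard-mono : ∀ {S T : ℤ → Set} {m n} → HasCard S m → HasCard T n → (∀ x → S x → T x) → m ≤ n
HasCard-mono {m = m} cardS cardT S⊆T = subst (m ≤_) (proj₂ (proj₂ (proj₂ cardT)))
  (HasCard⇒≤length cardS (proj₁ cardT) λ x Sx → HasCard-covers cardT x (S⊆T x Sx))

HasCard-cong : ∀ {S T : ℤ → Set} {m} → (∀ x → S x → T x) → (∀ x → T x → S x) → HasCard S m → HasCard T m
HasCard-cong S⇒T T⇒S (l , uniq , l⇔S , length≡m) =
  l , uniq , (λ x → mk⇔ (S⇒T x ∘ Equivalence.to (l⇔S x)) (Equivalence.from (l⇔S x) ∘ T⇒S x)) , length≡m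

DensityIs-cong : ∀ {f t r} {A A′ : ℤ → Set} → (∀ x → A x → A′ x) → (∀ x → A′ x → A x) →
  DensityIs f t A r → DensityIs f t A′ r
DensityIs-cong A⇒A′ A′⇒A density j with density j
... | M , bounds = M , λ X M≤X → case bounds X M≤X of λ where
  (a , b , cardA , cardOrbit , dist) →
    a , b , HasCard-cong (λ { x (Ax , rest) → A⇒A′ x Ax , rest }) (λ { x (A′x , rest) → A′⇒A x A′x , rest }) cardA , cardOrbit , dist

module OrbitDensity (f : ℤ → ℤ) (t : ℤ) (A : ℤ → Set) (r : ℝ) (density : DensityIs f t A r) where
  open Orbit f t

  orbit-below-finite : ∀ j X → proj₁ (density j) ℤ.≤ X → ∃[ l ] ∀ n → orbit n ℤ.≤ X → orbit n ∈ l
  orbit-below-finite j X M≤X with proj₂ (density j) X M≤X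
  ... | _ , _ , _ , cardOrbit , _ = proj₁ cardOrbit , λ n le → HasCard-covers cardOrbit (orbit n) ((n , refl) , le)

  full-density : (∀ n → A (orbit n)) → ∀ j → DistLe 1ℚ r (inv j)
  full-density all-in-A j with proj₂ (density j) (proj₁ (density j)) ℤP.≤-refl
  ... | a , b , cardA , cardOrbit , a/[1+b]≈r = subst (λ q → DistLe q r (inv j)) a/[1+b]≡1 a/[1+b]≈r
    where
    a≡1+b : a ≡ suc b
    a≡1+b = ℕP.≤-antisym (HasCard-mono cardA cardOrbit λ { x (_ , x∈O , x≤M) → x∈O , x≤M })
                         (HasCard-mono cardOrbit cardA λ { x ((n , refl) , x≤M) → all-in-A n , (n , refl) , x≤M })
    a/[1+b]≡1 : (+ a) / suc b ≡ 1ℚ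
    a/[1+b]≡1 = /-≡ a (suc b) 1 1 (trans (ℕP.*-identityʳ a) (trans a≡1+b (sym (ℕP.*-identityˡ (suc b)))))

  -- The window [S, S + L) of indices starts at a multiple of Q beyond the point N from which
  -- the orbit increases, so it covers c whole periods of G, and it is long enough for the S
  -- orbit points before it to contribute at most 1/(j + 1) to the ratio.
  module SieveWindow (wandering : Wandering f t) (B : ℕ) (grows : ∀ x → B ≤ ∣ x ∣ → suc ∣ x ∣ ≤ ∣ f x ∣)
           (G : ℕ → Bool) (Q : ℕ) .{{_ : ℕ.NonZero Q}} (G-periodic : ∀ x y → G (x + y * Q) ≡ G x)
           (G⇒∉A : ∀ m → 1 ≤ m → G m ≡ true → ¬ A (orbit m)) (j : ℕ) where

    M : ℤ
    M = proj₁ (density j)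

    X₀ : ℤ
    X₀ = + (∣ M ∣ + B)

    M≤X₀ : M ℤ.≤ X₀
    M≤X₀ = ℤP.≤-trans (i≤+∣i∣ M) (ℤ.+≤+ (ℕP.m≤m+n ∣ M ∣ B))

    eventually : ∃[ N ] ((∀ n → N ≤ n → X₀ ℤ.< orbit n) × (∀ n → N ≤ n → orbit n ℤ.< orbit (suc n)))
    eventually = eventually-above-and-increasing B grows wandering X₀ (ℤ.+≤+ (ℕP.m≤n+m B ∣ M ∣))
      (proj₁ below-X₀) (proj₂ below-X₀)
      where
      below-X₀ = orbit-below-finite j X₀ M≤X₀

    N : ℕ
    N = proj₁ eventually

    open StrictlyIncreasingFrom orbit N (proj₂ (proj₂ eventually))

    S c L last : ℕ
    S = suc N * Q
    c = suc (S * suc j + ∣ M ∣)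
    L = c * Q
    last = S + (L ∸ 1)

    X : ℤ
    X = orbit last

    instance
      L≢0 : ℕ.NonZero L
      L≢0 = ℕP.m*n≢0 c Q

    1+last≡L+S : suc last ≡ L + S
    1+last≡L+S = trans (cong suc (ℕP.+-comm S (L ∸ 1))) (cong (_+ S) (ℕP.suc-pred L))
    N≤S : N ≤ S
    N≤S = ℕP.≤-trans (ℕP.n≤1+n N) (ℕP.m≤m*n (suc N) Q)
    N≤last : N ≤ last
    N≤last = ℕP.≤-trans N≤S (ℕP.m≤m+n S (L ∸ 1))

    M≤X : M ℤ.≤ X
    M≤X = ℤP.≤-trans (i≤+∣i∣ M) (ℤP.<⇒≤ (subst (λ n → + ∣ M ∣ ℤ.< orbit n) (ℕP.m∸n+n≡m N≤last)
            (ℤP.≤-<-trans (ℤ.+≤+ ∣M∣≤last∸N) (index<value 0<orbit-N (last ∸ N)))))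
      where
      0<orbit-N : + 0 ℤ.< orbit N
      0<orbit-N = ℤP.≤-<-trans (ℤ.+≤+ z≤n) (proj₁ (proj₂ eventually) N ℕP.≤-refl)
      ∣M∣≤last∸N : ∣ M ∣ ≤ last ∸ N
      ∣M∣≤last∸N = begin
        ∣ M ∣               ≤⟨ ℕP.m≤n+m ∣ M ∣ (S * suc j) ⟩
        c ∸ 1               ≤⟨ ℕP.∸-monoˡ-≤ 1 (ℕP.m≤m*n c Q) ⟩
        L ∸ 1               ≤⟨ ℕP.m≤n+m (L ∸ 1) (S ∸ N) ⟩
        S ∸ N + (L ∸ 1)     ≡⟨ sym (ℕP.+-∸-comm (L ∸ 1) N≤S) ⟩
        last ∸ N            ∎
        where open ℕP.≤-Reasoning

    counts-at-X : Σ ℕ λ a → Σ ℕ λ b →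
      HasCard (OrbInAUpTo f t A X) a × HasCard (OrbUpTo f t X) (suc b) × DistLe ((+ a) / suc b) r (inv j)
    counts-at-X = proj₂ (density j) X M≤X

    a b : ℕ
    a = proj₁ counts-at-X
    b = proj₁ (proj₂ counts-at-X)

    cardA : HasCard (OrbInAUpTo f t A X) a
    cardA = proj₁ (proj₂ (proj₂ counts-at-X))

    cardOrbit : HasCard (OrbUpTo f t X) (suc b)
    cardOrbit = proj₁ (proj₂ (proj₂ (proj₂ counts-at-X)))

    count-G-window : count G S L ≡ c * count G 0 Q
    count-G-window = trans (count-shift G Q G-periodic (suc N) L) (count-periods G Q G-periodic c)

    a≤window-bound : a ≤ S + (L ∸ c * count G 0 Q)
    a≤window-bound = begin
      a                                                               ≤⟨ HasCard⇒≤length cardA candidates A-points∈candidates ⟩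
      length candidates                                               ≡⟨ LP.length-++ (applyUpTo orbit S) ⟩
      length (applyUpTo orbit S) + length (map orbit (indicesWhere (not ∘ G) S L))
        ≡⟨ cong₂ _+_ (LP.length-applyUpTo orbit S) (trans (LP.length-map orbit (indicesWhere (not ∘ G) S L)) (length-indicesWhere (not ∘ G) S L)) ⟩
      S + count (not ∘ G) S L                                         ≡⟨ cong (S ℕ.+_) count-not-G ⟩
      S + (L ∸ c * count G 0 Q)                                       ∎
      where
      open ℕP.≤-Reasoning
      candidates = applyUpTo orbit S ++ map orbit (indicesWhere (not ∘ G) S L)
      count-not-G : count (not ∘ G) S L ≡ L ∸ c * count G 0 Q
      count-not-G = trans (sym (ℕP.m+n∸m≡n (count G S L) _))
        (cong₂ _∸_ (count-+-count-not G S L) count-G-window)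
      1≤S : 1 ≤ S
      1≤S = ℕ.>-nonZero⁻¹ S {{ℕP.m*n≢0 (suc N) Q}}
      candidate : ∀ n → A (orbit n) → orbit n ℤ.≤ X → orbit n ∈ candidates
      candidate n A-orbit-n orbit-n≤X with n <? S
      ... | yes n<S = ∈-++⁺ˡ (∈-applyUpTo⁺ orbit n<S)
      ... | no n≮S = ∈-++⁺ʳ (applyUpTo orbit S) (∈-map⁺ orbit (∈-indicesWhere⁺ (not ∘ G) L S≤n n<L+S (cong not G-n≡false)))
        where
        S≤n = ℕP.≮⇒≥ n≮S
        n<L+S : n < L + S
        n<L+S = subst (n <_) 1+last≡L+S (s≤s (≤-reflect N≤last orbit-n≤X))
        G-n≡false : G n ≡ false
        G-n≡false with G n in G-n
        ... | true  = ⊥-elim (G⇒∉A n (ℕP.≤-trans 1≤S S≤n) G-n A-orbit-n)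
        ... | false = refl
      A-points∈candidates : ∀ x → OrbInAUpTo f t A X x → x ∈ candidates
      A-points∈candidates x (Ax , (n , refl) , x≤X) = candidate n Ax x≤X

    L≤1+b : L ≤ suc b
    L≤1+b = subst (_≤ suc b) (LP.length-applyUpTo window L)
      (length≤HasCard cardOrbit (applyUpTo⁺₁ window L window-injective) window⊆orbit≤X)
      where
      window : ℕ → ℤ
      window i = orbit (S + i)
      window-injective : ∀ {i k} → i < k → k < L → window i ≢ window k
      window-injective {i} {k} i<k _ eq = ℕP.<⇒≢ i<k (ℕP.+-cancelˡ-≡ S i k
        (injective (ℕP.≤-trans N≤S (ℕP.m≤m+n S i)) (ℕP.≤-trans N≤S (ℕP.m≤m+n S k)) eq))
      window⊆orbit≤X : ∀ x → x ∈ applyUpTo window L → OrbUpTo f t X x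
      window⊆orbit≤X x x∈ with ∈-applyUpTo⁻ window x∈
      ... | i , i<L , refl = (S + i , refl) ,
        ≤-mono (ℕP.≤-trans N≤S (ℕP.m≤m+n S i))
          (ℕP.≤-pred (subst (suc (S + i) ≤_) (trans (ℕP.+-comm S L) (sym 1+last≡L+S)) (ℕP.+-monoʳ-< S i<L)))

    density-≤ : ∃[ q ] (DistLe q r (inv j) × q ℚ.≤ (1ℚ ℚ.- (+ count G 0 Q) / Q) ℚ.+ inv j)
    density-≤ = (+ a) / suc b , proj₂ (proj₂ (proj₂ (proj₂ counts-at-X))) ,
      window-ratio-bound j (count-≤ G 0 Q) (ℕP.≤-trans (ℕP.m≤m+n (S * suc j) ∣ M ∣) (ℕP.n≤1+n _)) a≤window-bound L≤1+b

-- Unions of arithmetic progressions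

InOrbPMUnion⇒InAPUnion : ∀ {k} (as : Fin k → ℤ) t x → InOrbPMUnion k as t x → InAPUnion k (∣_∣ ∘ as) t x
InOrbPMUnion⇒InAPUnion as t x (s , n , refl) =
  s , ND.divides ∣ n ∣ (trans (cong ∣_∣ (t+m-t≡m t (n ℤ.* as s))) (ℤP.abs-* n (as s)))
  where
  t+m-t≡m : ∀ t m → t ℤ.+ m ℤ.- t ≡ m
  t+m-t≡m = ℤSolver.solve-∀

private
  x≡t+[x-t] : ∀ x t → x ≡ t ℤ.+ (x ℤ.- t)
  x≡t+[x-t] = ℤSolver.solve-∀
  n*[-a]≡[-n]*a : ∀ n a → n ℤ.* (ℤ.- a) ≡ (ℤ.- n) ℤ.* a
  n*[-a]≡[-n]*a = ℤSolver.solve-∀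

InAPUnion⇒InOrbPMUnion : ∀ {k} (as : Fin k → ℤ) t x → InAPUnion k (∣_∣ ∘ as) t x → InOrbPMUnion k as t x
InAPUnion⇒InOrbPMUnion as t x (s , ∣as∣∣x-t) with Sgn.∣ᵤ⇒∣ {+ ∣ as s ∣} ∣as∣∣x-t | ℤP.+∣i∣≡i⊎+∣i∣≡-i (as s)
... | divides n x-t≡n∣as∣ | inj₁ ∣as∣≡as  =
  s , n , trans (x≡t+[x-t] x t) (cong (λ y → t ℤ.+ y) (trans x-t≡n∣as∣ (cong (n ℤ.*_) ∣as∣≡as)))
... | divides n x-t≡n∣as∣ | inj₂ ∣as∣≡-as =
  s , ℤ.- n , trans (x≡t+[x-t] x t) (cong (λ y → t ℤ.+ y) (trans x-t≡n∣as∣ (trans (cong (n ℤ.*_) ∣as∣≡-as) (n*[-a]≡[-n]*a n (as s)))))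

module AccessibilityBound {d} (2≤d : 2 ≤ d) (c : Fin (suc d) → ℤ) (c-lead≢0 : c (fromℕ d) ≢ + 0)
  (t : ℤ) (wandering : Wandering (evalPoly c) t) (r : ℝ) (k : ℕ) (ns : Fin k → ℕ)
  (density : DensityIs (evalPoly c) t (InAPUnion k ns t) r) where

  open Orbit (evalPoly c) t
  open OrbitModulo (evalPoly c) (evalPoly-mod c) t
  open OrbitDensity (evalPoly c) t (InAPUnion k ns t) r density

  returns⇒InAPUnion : ∀ s m → Returns (ns s) m → InAPUnion k ns t (orbit m)
  returns⇒InAPUnion s m r = s , Sgn.∣⇒∣ᵤ (divides-difference r)

  InAPUnion⇒returns : ∀ m → InAPUnion k ns t (orbit m) → ∃[ s ] Returns (ns s) m
  InAPUnion⇒returns m (s , ns∣) = s , congruent (Sgn.∣ᵤ⇒∣ ns∣)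

  returns-at-1⇒¬r<1 : ∃[ s ] Returns (ns s) 1 → ¬ r ℝ< 1ℚ
  returns-at-1⇒¬r<1 (s , r₁) r<1 =
    ℝ<⇒¬approximable {r} {1ℚ} r<1 (full-density λ n → returns⇒InAPUnion s n (returns-at-1⇒always r₁ n))

  module _ (p : ℕ → ℕ) (p-enumerates : IsPrimeEnumeration p) (no-return-at-1 : ∀ s → ¬ Returns (ns s) 1) where
    private
      p-prime : ∀ i → Prime (p i)
      p-prime = proj₁ p-enumerates
      p-increasing : ∀ i → p i < p (suc i)
      p-increasing = proj₁ (proj₂ p-enumerates)
      p-onto : ∀ q → Prime q → ∃[ i ] (p i ≡ q)
      p-onto = proj₂ (proj₂ p-enumerates)
    open Sieve p p-prime p-increasing

    prime-of : ∀ s → ∃[ q ] (Prime q × ∀ m → 1 ≤ m → Returns (ns s) m → q ND.∣ m)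
    prime-of s = prime-divides-return-times wandering (ns s) (no-return-at-1 s)

    prime-index : Fin k → ℕ
    prime-index s = proj₁ (p-onto (proj₁ (prime-of s)) (proj₁ (proj₂ (prime-of s))))

    p[prime-index]∣ : ∀ s m → 1 ≤ m → Returns (ns s) m → p (prime-index s) ND.∣ m
    p[prime-index]∣ s m 1≤m returns = subst (ND._∣ m) (sym (proj₂ (p-onto (proj₁ (prime-of s)) (proj₁ (proj₂ (prime-of s))))))
      (proj₂ (proj₂ (prime-of s)) m 1≤m returns)


    sel : ℕ → Bool
    sel = selectedBy prime-index

    B : ℕ
    B = sumFinℕ k (suc ∘ prime-index)

    Q : ℕ
    Q = modulus sel B

    G : ℕ → Bool
    G = survives sel B

    instance
      Q≢0 : ℕ.NonZero Q
      Q≢0 = modulus≢0 sel B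

    survivor⇒∉A : ∀ m → 1 ≤ m → G m ≡ true → ¬ InAPUnion k ns t (orbit m)
    survivor⇒∉A m 1≤m G-m A-orbit-m = true≢false (trans (sym G-m)
      (survives-divisible sel B (image<sum prime-index s) (selectedBy-image prime-index s) (p[prime-index]∣ s m 1≤m returns)))
      where
      s = proj₁ (InAPUnion⇒returns m A-orbit-m)
      returns = proj₂ (InAPUnion⇒returns m A-orbit-m)
      true≢false : true ≢ false
      true≢false ()

    1-survivor-ratio≤δ : 1ℚ ℚ.- (+ count G 0 Q) / Q ℚ.≤ deltaK p k
    1-survivor-ratio≤δ = begin
      1ℚ ℚ.- (+ count G 0 Q) / Q                      ≡⟨ cong (λ n → 1ℚ ℚ.- (+ n) / Q) (count-survives sel B) ⟩
      1ℚ ℚ.- (+ survivorCount sel B) / Q              ≤⟨ ℚP.+-monoʳ-≤ 1ℚ (ℚP.neg-antimono-≤ totient-ratio≤survivor-ratio) ⟩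
      1ℚ ℚ.- ((+ totientProduct k) / primeProduct k) {{primeProduct≢0 k}} ≡⟨ cong (λ x → 1ℚ ℚ.- x) (sym (prodPrimes≡totient/prime k)) ⟩
      deltaK p k                                      ∎
      where
      open ℚP.≤-Reasoning
      totient-ratio≤survivor-ratio : ((+ totientProduct k) / primeProduct k) {{primeProduct≢0 k}} ℚ.≤ (+ survivorCount sel B) / Q
      totient-ratio≤survivor-ratio = /-≤ (totientProduct k) (primeProduct k) (survivorCount sel B) Q {{primeProduct≢0 k}}
        (subst (_≤ survivorCount sel B * primeProduct k) (ℕP.*-comm Q (totientProduct k))
          (survivor-density-≥ sel B (count-selectedBy prime-index 0 B)))

    ¬δ<r : ¬ deltaK p k <ℝ r
    ¬δ<r δ<r = <ℝ⇒¬approximable-from-below {deltaK p k} {r} δ<r approximable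
      where
      escape = evalPoly-escapes 2≤d c c-lead≢0
      approximable : ∀ j → ∃[ q ] (DistLe q r (inv j) × q ℚ.≤ deltaK p k ℚ.+ inv j)
      approximable j = proj₁ bound , proj₁ (proj₂ bound) , ℚP.≤-trans (proj₂ (proj₂ bound)) (ℚP.+-monoˡ-≤ (inv j) 1-survivor-ratio≤δ)
        where
        bound = SieveWindow.density-≤ wandering (proj₁ escape) (proj₂ escape) G Q (survives-periodic sel B) survivor⇒∉A j

  density-contradiction : r ℝ< 1ℚ → ∀ p → IsPrimeEnumeration p → deltaK p k <ℝ r → ⊥
  density-contradiction r<1 p p-enumerates δ<r with FinP.any? (λ s → returns? (ns s) 1)
  ... | yes returns-at-1  = returns-at-1⇒¬r<1 returns-at-1 r<1
  ... | no ∄return-at-1 = ¬δ<r p p-enumerates (λ s r₁ → ∄return-at-1 (s , r₁)) δ<r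

theorem6p6 : (d : ℕ) → 2 ≤ d → (c : Fin (suc d) → ℤ) → c (fromℕ d) ≢ + 0 →
  (t : ℤ) → Wandering (evalPoly c) t →
  (r : ℝ) → 0ℚ <ℝ r → r ℝ< 1ℚ →
  (p : ℕ → ℕ) → IsPrimeEnumeration p →
  (k : ℕ) → 1 ≤ k → deltaK p k <ℝ r →
  ¬ Accessible (evalPoly c) t k r
    × ((as : Fin k → ℤ) → ¬ DensityIs (evalPoly c) t (InOrbPMUnion k as t) r)
theorem6p6 d 2≤d c c-lead≢0 t wandering r _ r<1 p p-enumerates k _ δ<r =
  (λ (ns , _ , density) → progressions-inaccessible ns density) ,
  (λ as density → progressions-inaccessible (∣_∣ ∘ as)
     (DensityIs-cong {evalPoly c} {t} {r} (InOrbPMUnion⇒InAPUnion as t) (InAPUnion⇒InOrbPMUnion as t) density))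
  where
  progressions-inaccessible : (ns : Fin k → ℕ) → ¬ DensityIs (evalPoly c) t (InAPUnion k ns t) r
  progressions-inaccessible ns density =
    AccessibilityBound.density-contradiction 2≤d c c-lead≢0 t wandering r k ns density r<1 p p-enumerates δ<r
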